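{- Let $u$ be a single-rooted minimal $\mathbf{C}^\infty$-word of height $k>0$ and let $U\in\Sigma^k$ be its left frontier. Then $u$ is a prefix of each of the following three $\mathbf{C}^\infty$-words of height $k+1$: the single-rooted minimal word with left frontier $U1$ (the right $1$-extension of $u$), the single-rooted minimal word with left frontier $U2$ (the right $2$-extension of $u$), and the shortest $\mathbf{C}^\infty$-word with left frontier $U0$ (the right $0$-extension of $u$), which is single-rooted and not minimal. Moreover, the minimal part of the right $0$-extension of $u$ is the single-rooted minimal word whose left frontier is $\Theta(U)2$.
   Context: Let $\Sigma=\{1,2\}$, $\Sigma_0=\{0,1,2\}$; $w[i]$ is the $(i+1)$-th letter of $w$, $\tilde w$ the reversal; juxtaposition denotes concatenation. For $w=x_1^{i_1}\cdots x_n^{i_n}$ over $\Sigma$ (maximal runs), $\Delta(w)=i_1\cdots i_n$. The derivative: $D(\epsilon)=\epsilon$, otherwise (when $\Delta(w)$ is over $\Sigma$) $D(w)$ is $\Delta(w)$ with its first symbol deleted if it is $1$ and its last symbol deleted if it is $1$. $\mathbf{C}^{\infty}$ is the set of words with $D^j(w)$ defined for all $j$. Height: least $k$ with $D^k(w)=\epsilon$; root: $D^{k-1}(w)$; single-/double-rooted if the root has length one/two. A primitive of $w$ is $w'$ with $D(w')=w$. $w\in\mathbf{C}^{\infty}$ of height $k>1$ is minimal if for each $0\le j\le k-2$, $D^j(w)$ is a primitive of $D^{j+1}(w)$ of minimal length among all its primitives; words of height $1$ are minimal. Left frontier of $w$ of height $k>0$: the word $\Psi(w)$ of length $k$ over $\Sigma_0$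 with $\Psi(w)[0]=w[0]$ and for $0<i<k$, $\Psi(w)[i]=0$ if $D^i(w)[0]=2$ and $D^{i-1}(w)[0]\ne D^{i-1}(w)[1]$, else $\Psi(w)[i]=D^i(w)[0]$. Right frontier: $\Psi(\tilde w)$. Each $U\in\Sigma^*$ is the left frontier of a unique single-rooted minimal word and of a unique double-rooted minimal word; $\Gamma_s(U)$ (resp. $\Gamma_d(U)$) is the right frontier of the single-rooted (resp. double-rooted) minimal word with left frontier $U$, and $\Theta=\Gamma_s\circ\Gamma_d$. Every $w\in\mathbf{C}^\infty$ of height $k>0$ contains a factor that is a single-rooted minimal word of height $k$; the minimal part of $w$ is the first (leftmost occurring) such factor. -}

module Defs where

open import Data.Nat using (ℕ; zero; suc; _≤_; _<_)
open import Data.List using (List; []; _∷_; _++_; length; reverse)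
open import Data.Maybe using (Maybe; just; nothing; _>>=_)
import Data.Maybe as Maybe
open import Data.Product using (Σ; ∃; _×_; _,_)
open import Relation.Binary.PropositionalEquality using (_≡_; _≢_)
open import Relation.Nullary using (¬_)

data Sym : Set where
  one two : Sym

data Sym0 : Set where
  z0 z1 z2 : Sym0

emb : Sym → Sym0
emb one = z1
emb two = z2

embW : List Sym → List Sym0
embW [] = []
embW (x ∷ xs) = emb x ∷ embW xs

-- (i+1)-th letter, w[i]
at : {A : Set} → List A → ℕ → Maybe A
at [] _ = nothing
at (x ∷ xs) zero = just x
at (x ∷ xs) (suc i) = at xs i

-- Run-length encoding Δ (lengths of maximal runs, as natural numbers)


runsFrom : Sym → ℕ → List Sym → List ℕ
runsFrom x n [] = n ∷ []
runsFrom one n (one ∷ ys) = runsFrom one (suc n) ys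
runsFrom two n (two ∷ ys) = runsFrom two (suc n) ys
runsFrom one n (two ∷ ys) = n ∷ runsFrom two 1 ys
runsFrom two n (one ∷ ys) = n ∷ runsFrom one 1 ys

runs : List Sym → List ℕ
runs [] = []
runs (x ∷ xs) = runsFrom x 1 xs

toSym : ℕ → Maybe Sym
toSym 1 = just one
toSym 2 = just two
toSym _ = nothing

allToSym : List ℕ → Maybe (List Sym)
allToSym [] = just []
allToSym (n ∷ ns) = toSym n >>= λ x → allToSym ns >>= λ xs → just (x ∷ xs)

Δ : List Sym → Maybe (List Sym)
Δ w = allToSym (runs w)

dropFirstOne : List Sym → List Sym
dropFirstOne (one ∷ xs) = xs
dropFirstOne xs = xs

dropLastOne : List Sym → List Sym
dropLastOne xs = reverse (dropFirstOne (reverse xs))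

D : List Sym → Maybe (List Sym)
D [] = just []
D w@(_ ∷ _) = Δ w >>= λ d → just (dropLastOne (dropFirstOne d))

Dⁿ : ℕ → List Sym → Maybe (List Sym)
Dⁿ zero w = just w
Dⁿ (suc j) w = Dⁿ j w >>= D

C∞ : List Sym → Set
C∞ w = ∀ j → ∃ λ v → Dⁿ j w ≡ just v

Height : List Sym → ℕ → Set
Height w k = (Dⁿ k w ≡ just []) × (∀ j → j < k → Dⁿ j w ≢ just [])

-- single-/double-rooted (root D^{k-1}(w) of length one / two), height k = suc k'
SingleRooted : List Sym → Set
SingleRooted w = C∞ w × Σ ℕ λ k' → Height w (suc k') × ∃ λ x → Dⁿ k' w ≡ just (x ∷ [])

DoubleRooted : List Sym → Set
DoubleRooted w = C∞ w × Σ ℕ λ k' → Height w (suc k') × ∃ λ x → ∃ λ y → Dⁿ k' w ≡ just (x ∷ y ∷ [])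

Primitive : List Sym → List Sym → Set
Primitive w' w = D w' ≡ just w

Minimal : List Sym → Set
Minimal w = C∞ w × Σ ℕ λ k → Height w k × 1 ≤ k ×
  (∀ j x y → suc (suc j) ≤ k → Dⁿ j w ≡ just x → Dⁿ (suc j) w ≡ just y →
     ∀ v → Primitive v y → length x ≤ length v)

SingleRootedMinimal : List Sym → Set
SingleRootedMinimal w = SingleRooted w × Minimal w

DoubleRootedMinimal : List Sym → Set
DoubleRootedMinimal w = DoubleRooted w × Minimal w

-- Ψ(w)[i] for 0 < i < k, from a = D^{i-1}(w) and b = D^i(w)
entry : Sym → Sym → Sym → Sym0
entry one two two = z0
entry two one two = z0
entry _ _ b = emb b

psiEntry : List Sym → List Sym → Maybe Sym0
psiEntry (x ∷ y ∷ _) (b ∷ _) = just (entry x y b)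
psiEntry _ _ = nothing

LeftFrontier : List Sym → List Sym0 → Set
LeftFrontier w U = C∞ w × Σ ℕ λ k → Height w k × 0 < k × length U ≡ k ×
  (at U 0 ≡ Maybe.map emb (at w 0)) ×
  (∀ m a b → suc m < k → Dⁿ m w ≡ just a → Dⁿ (suc m) w ≡ just b →
     at U (suc m) ≡ psiEntry a b)

RightFrontier : List Sym → List Sym0 → Set
RightFrontier w V = LeftFrontier (reverse w) V

-- Γ_s(U) = V, Γ_d(U) = V (as relations; they are functions by uniqueness)
Γs : List Sym0 → List Sym0 → Set
Γs U V = ∃ λ m → SingleRootedMinimal m × LeftFrontier m U × RightFrontier m V

Γd : List Sym0 → List Sym0 → Set
Γd U V = ∃ λ m → DoubleRootedMinimal m × LeftFrontier m U × RightFrontier m V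

Θ : List Sym0 → List Sym0 → Set
Θ U T = ∃ λ V → Γd U V × Γs V T

IsPrefix : List Sym → List Sym → Set
IsPrefix u w = ∃ λ s → u ++ s ≡ w

MinOccurrence : List Sym → ℕ → List Sym → List Sym → Set
MinOccurrence w k p m = SingleRootedMinimal m × Height m k × ∃ λ s → p ++ m ++ s ≡ w

MinimalPart : List Sym → List Sym → Set
MinimalPart w m = Σ ℕ λ k → Height w k × 0 < k × ∃ λ p → MinOccurrence w k p m ×
  (∀ p' m' → MinOccurrence w k p' m' → length p ≤ length p')

module Submission where

-- A word is recovered from its first letter and its run-length encoding, so a
-- C∞-word is the same thing as its derivative tower w = w₀, w₁ = D w₀, …,
-- together with the first letter of every level.  The shortest primitive of a
-- nonempty word y has run-length encoding  pad y = lpad y ++ y ++ rpad y, where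
-- a 1 is added on each side on which y begins/ends with 1; hence the tower of
-- a minimal word is obtained from its root by repeatedly decoding  pad  with
-- the letters of its left frontier.
--
-- For the theorem, every level of u
-- below its root x is the shortest primitive of the next; a word with left
-- frontier U1, U2 or U0 has the same first letters and its level K starts
-- with x, so prefixes lift down to u being a prefix of it.  The shortest word with
-- frontier U0 is the lift of x x̄ x̄ (with root 2), which is not minimal; its
-- minimal part is located by descending occurrences, and its tower is, level
-- by level, a prefix of the minimal tower and a suffix of the double-rooted
-- minimal word with frontier U, which identifies its left frontier as Θ(U)2.

open import Defs
open import Data.Nat using (ℕ; zero; suc; _+_; _∸_; _≤_; _<_; z≤n; s≤s)
open import Data.Nat.Properties using (m≤n⇒m<n∨m≡n; +-mono-<-≤; +-mono-≤-<; +-monoʳ-<; m≤n⇒m≤1+n; ≤-refl; ≤-trans; +-suc; +-identityʳ; n≮n; +-comm; m≤m+n; +-monoʳ-≤; +-mono-≤; <-cmp; <⇒≤; m+[n∸m]≡n; n≤1+n; suc-injective; +-cancelʳ-≤; m<m+n)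
open import Data.List using (List; []; _∷_; _++_; length; reverse; replicate; map; _∷ʳ_; initLast; _∷ʳ′_)
open import Data.List.Properties using (∷ʳ-injectiveˡ; ∷ʳ-injectiveʳ; ++-cancelˡ; ++-assoc; ++-identityʳ; ++-conicalˡ; ++-conicalʳ; reverse-++; reverse-involutive; length-++; length-reverse; ∷-injective; unfold-reverse; reverse-map)
open import Data.Maybe using (just; nothing; _>>=_)
import Data.Maybe as Maybe
open import Data.Maybe.Properties using (just-injective)
open import Data.Product using (∃; ∃₂; _×_; _,_; proj₁; proj₂)
open import Data.Sum using (_⊎_; inj₁; inj₂)
open import Data.Empty using (⊥; ⊥-elim)
open import Relation.Binary.PropositionalEquality using (module ≡-Reasoning; _≡_; _≢_; refl; sym; trans; cong; cong₂; subst; subst₂)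
open import Relation.Nullary using (¬_)
open import Relation.Binary.Definitions using (tri<; tri≈; tri>)

-- The letter different from a; consecutive runs of a word alternate letters.
other : Sym → Sym
other one = two
other two = one

other-involutive : ∀ a → other (other a) ≡ a
other-involutive one = refl
other-involutive two = refl

other-≢ : ∀ a → other a ≢ a
other-≢ one ()
other-≢ two ()

run : Sym → Sym → List Sym
run one a = a ∷ []
run two a = a ∷ a ∷ []

decode : Sym → List Sym → List Sym
decode a [] = []
decode a (r ∷ rs) = run r a ++ decode (other a) rs

exitLetter : List Sym → Sym → Sym
exitLetter [] a = a
exitLetter (_ ∷ rs) a = exitLetter rs (other a)

decode-++ : ∀ a A B → decode a (A ++ B) ≡ decode a A ++ decode (exitLetter A a) B
decode-++ a [] B = refl
decode-++ a (r ∷ A) B rewrite decode-++ (other a) A B = sym (++-assoc (run r a) (decode (other a) A) _)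

-- First letter (with a dummy value on the empty word).
first : List Sym → Sym
first [] = one
first (x ∷ _) = x

-- The weight of an encoding is the length of the word it decodes to.
weight : List Sym → ℕ
weight [] = 0
weight (one ∷ d) = suc (weight d)
weight (two ∷ d) = suc (suc (weight d))

weight-++ : ∀ A B → weight (A ++ B) ≡ weight A + weight B
weight-++ [] B = refl
weight-++ (one ∷ A) B = cong suc (weight-++ A B)
weight-++ (two ∷ A) B = cong (λ z → suc (suc z)) (weight-++ A B)

length-decode : ∀ a d → length (decode a d) ≡ weight d
length-decode a [] = refl
length-decode a (one ∷ d) = cong suc (length-decode (other a) d)
length-decode a (two ∷ d) = cong (λ z → suc (suc z)) (length-decode (other a) d)

decode-nonempty : ∀ c d → d ≢ [] → decode c d ≢ []
decode-nonempty c [] ne _ = ne refl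
decode-nonempty c (one ∷ d) ne ()
decode-nonempty c (two ∷ d) ne ()

++-nonemptyʳ : ∀ {A : Set} (P Q : List A) → Q ≢ [] → P ++ Q ≢ []
++-nonemptyʳ P Q ne e = ne (++-conicalʳ P Q e)

++-nonemptyˡ : ∀ {A : Set} (P Q : List A) → P ≢ [] → P ++ Q ≢ []
++-nonemptyˡ P Q ne e = ne (++-conicalˡ P Q e)

-- The padding that makes pad y the encoding of the shortest primitive of y.
lpad : List Sym → List Sym
lpad (one ∷ _) = one ∷ []
lpad _ = []

rpad : List Sym → List Sym
rpad y = lpad (reverse y)

pad : List Sym → List Sym
pad y = lpad y ++ y ++ rpad y

rpad-∷ʳ-one : ∀ xs → rpad (xs ∷ʳ one) ≡ one ∷ []
rpad-∷ʳ-one xs rewrite reverse-++ xs (one ∷ []) = refl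

rpad-∷ʳ-two : ∀ xs → rpad (xs ∷ʳ two) ≡ []
rpad-∷ʳ-two xs rewrite reverse-++ xs (two ∷ []) = refl

lpad-cases : ∀ y → lpad y ≡ [] ⊎ lpad y ≡ one ∷ []
lpad-cases [] = inj₁ refl
lpad-cases (one ∷ y) = inj₂ refl
lpad-cases (two ∷ y) = inj₁ refl

rpad-cases : ∀ y → rpad y ≡ [] ⊎ rpad y ≡ one ∷ []
rpad-cases y = lpad-cases (reverse y)

rpad-++ : ∀ A B → B ≢ [] → rpad (A ++ B) ≡ rpad B
rpad-++ A B ne with initLast B
... | [] = ⊥-elim (ne refl)
... | ys ∷ʳ′ one rewrite sym (++-assoc A ys (one ∷ [])) = trans (rpad-∷ʳ-one (A ++ ys)) (sym (rpad-∷ʳ-one ys))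
... | ys ∷ʳ′ two rewrite sym (++-assoc A ys (two ∷ [])) = trans (rpad-∷ʳ-two (A ++ ys)) (sym (rpad-∷ʳ-two ys))

lpad-++ : ∀ A B → A ≢ [] → lpad (A ++ B) ≡ lpad A
lpad-++ [] B ne = ⊥-elim (ne refl)
lpad-++ (one ∷ A) B ne = refl
lpad-++ (two ∷ A) B ne = refl

pad-nonempty : ∀ y → y ≢ [] → pad y ≢ []
pad-nonempty [] ne = ⊥-elim (ne refl)
pad-nonempty (one ∷ y) ne ()
pad-nonempty (two ∷ y) ne ()

weight-pad : ∀ y → weight (pad y) ≡ weight (lpad y) + (weight y + weight (rpad y))
weight-pad y = trans (weight-++ (lpad y) (y ++ rpad y)) (cong (weight (lpad y) +_) (weight-++ y (rpad y)))

dropLastOne-∷ʳ-one : ∀ xs → dropLastOne (xs ∷ʳ one) ≡ xs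
dropLastOne-∷ʳ-one xs rewrite reverse-++ xs (one ∷ []) = reverse-involutive xs

dropLastOne-∷ʳ-two : ∀ xs → dropLastOne (xs ∷ʳ two) ≡ xs ∷ʳ two
dropLastOne-∷ʳ-two xs rewrite reverse-++ xs (two ∷ []) =
  trans (cong reverse (sym (reverse-++ xs (two ∷ [])))) (reverse-involutive _)

unpad-pad : ∀ y → y ≢ [] → dropLastOne (dropFirstOne (pad y)) ≡ y
unpad-pad y ne = trans (cong dropLastOne (dropFirst-pad y ne)) (dropLast-rpad y)
  where
  dropFirst-pad : ∀ y → y ≢ [] → dropFirstOne (pad y) ≡ y ++ rpad y
  dropFirst-pad [] ne = ⊥-elim (ne refl)
  dropFirst-pad (one ∷ y) ne = refl
  dropFirst-pad (two ∷ y) ne = refl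
  dropLast-rpad : ∀ y → dropLastOne (y ++ rpad y) ≡ y
  dropLast-rpad y with initLast y
  ... | [] = refl
  ... | e ∷ʳ′ one rewrite rpad-∷ʳ-one e = dropLastOne-∷ʳ-one (e ∷ʳ one)
  ... | e ∷ʳ′ two rewrite rpad-∷ʳ-two e | ++-identityʳ (e ∷ʳ two) = dropLastOne-∷ʳ-two e

runLength : Sym → ℕ
runLength one = 1
runLength two = 2

runsFrom-decode : ∀ c n rs → runsFrom c n (decode (other c) rs) ≡ n ∷ map runLength rs
runsFrom-decode c n [] = refl
runsFrom-decode one n (one ∷ rs) = cong (n ∷_) (runsFrom-decode two 1 rs)
runsFrom-decode one n (two ∷ rs) = cong (n ∷_) (runsFrom-decode two 2 rs)
runsFrom-decode two n (one ∷ rs) = cong (n ∷_) (runsFrom-decode one 1 rs)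
runsFrom-decode two n (two ∷ rs) = cong (n ∷_) (runsFrom-decode one 2 rs)

runs-decode : ∀ c d → runs (decode c d) ≡ map runLength d
runs-decode c [] = refl
runs-decode c (one ∷ rs) = runsFrom-decode c 1 rs
runs-decode one (two ∷ rs) = runsFrom-decode one 2 rs
runs-decode two (two ∷ rs) = runsFrom-decode two 2 rs

allToSym-runLengths : ∀ d → allToSym (map runLength d) ≡ just d
allToSym-runLengths [] = refl
allToSym-runLengths (one ∷ d) rewrite allToSym-runLengths d = refl
allToSym-runLengths (two ∷ d) rewrite allToSym-runLengths d = refl

Δ-decode : ∀ c d → Δ (decode c d) ≡ just d
Δ-decode c d rewrite runs-decode c d = allToSym-runLengths d

decodeℕ : Sym → List ℕ → List Sym
decodeℕ a [] = []
decodeℕ a (n ∷ ns) = replicate n a ++ decodeℕ (other a) ns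

replicate-++-∷ : ∀ {A : Set} n (x : A) ys → replicate n x ++ x ∷ ys ≡ x ∷ (replicate n x ++ ys)
replicate-++-∷ zero x ys = refl
replicate-++-∷ (suc n) x ys = cong (x ∷_) (replicate-++-∷ n x ys)

runsFrom-decodeℕ : ∀ x n ys → replicate n x ++ ys ≡ decodeℕ x (runsFrom x n ys)
runsFrom-decodeℕ x n [] = refl
runsFrom-decodeℕ one n (one ∷ ys) = trans (replicate-++-∷ n one ys) (runsFrom-decodeℕ one (suc n) ys)
runsFrom-decodeℕ one n (two ∷ ys) = cong (replicate n one ++_) (runsFrom-decodeℕ two 1 ys)
runsFrom-decodeℕ two n (one ∷ ys) = cong (replicate n two ++_) (runsFrom-decodeℕ one 1 ys)
runsFrom-decodeℕ two n (two ∷ ys) = trans (replicate-++-∷ n two ys) (runsFrom-decodeℕ two (suc n) ys)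

decodeℕ-runLengths : ∀ c d → decodeℕ c (map runLength d) ≡ decode c d
decodeℕ-runLengths c [] = refl
decodeℕ-runLengths c (one ∷ d) = cong (c ∷_) (decodeℕ-runLengths (other c) d)
decodeℕ-runLengths c (two ∷ d) = cong (λ z → c ∷ c ∷ z) (decodeℕ-runLengths (other c) d)

allToSym-inverse : ∀ ns d → allToSym ns ≡ just d → ns ≡ map runLength d
allToSym-inverse [] .[] refl = refl
allToSym-inverse (zero ∷ ns) d ()
allToSym-inverse (suc zero ∷ ns) d eq with allToSym ns in e
allToSym-inverse (suc zero ∷ ns) .(one ∷ xs) refl | just xs = cong (1 ∷_) (allToSym-inverse ns xs e)
allToSym-inverse (suc zero ∷ ns) d () | nothing
allToSym-inverse (suc (suc zero) ∷ ns) d eq with allToSym ns in e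
allToSym-inverse (suc (suc zero) ∷ ns) .(two ∷ xs) refl | just xs = cong (2 ∷_) (allToSym-inverse ns xs e)
allToSym-inverse (suc (suc zero) ∷ ns) d () | nothing
allToSym-inverse (suc (suc (suc n)) ∷ ns) d ()

decode-Δ : ∀ x w d → Δ (x ∷ w) ≡ just d → x ∷ w ≡ decode x d
decode-Δ x w d eq = begin
  x ∷ w                              ≡⟨ runsFrom-decodeℕ x 1 w ⟩
  decodeℕ x (runsFrom x 1 w)         ≡⟨ cong (decodeℕ x) (allToSym-inverse (runsFrom x 1 w) d eq) ⟩
  decodeℕ x (map runLength d)        ≡⟨ decodeℕ-runLengths x d ⟩
  decode x d                         ∎
  where open ≡-Reasoning

length-via-Δ : ∀ x w d → Δ (x ∷ w) ≡ just d → length (x ∷ w) ≡ weight d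
length-via-Δ x w d eq = trans (cong length (decode-Δ x w d eq)) (length-decode x d)

D-via-Δ : ∀ w d → Δ w ≡ just d → D w ≡ just (dropLastOne (dropFirstOne d))
D-via-Δ [] d refl = refl
D-via-Δ (x ∷ w) d e rewrite e = refl

D-undefined : ∀ w → Δ w ≡ nothing → D w ≡ nothing
D-undefined [] ()
D-undefined (x ∷ w) e rewrite e = refl

D-defined : ∀ w y → D w ≡ just y → ∃ λ d → Δ w ≡ just d × dropLastOne (dropFirstOne d) ≡ y
D-defined w y eq with Δ w in e
... | just d = d , refl , just-injective (trans (sym (D-via-Δ w d e)) eq)
... | nothing with () ← trans (sym (D-undefined w e)) eq

D-decode-pad : ∀ c y → y ≢ [] → D (decode c (pad y)) ≡ just y
D-decode-pad c y ne = trans (D-via-Δ (decode c (pad y)) (pad y) (Δ-decode c (pad y))) (cong just (unpad-pad y ne))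

-- Shape of primitives: a primitive of y has encoding l ++ y ++ r, where each
-- side is either the forced padding or an optional extra 1.
LeftPad : List Sym → List Sym → Set
LeftPad l y = (l ≡ lpad y) ⊎ (l ≡ one ∷ [] × lpad y ≡ [])

RightPad : List Sym → List Sym → Set
RightPad r y = (r ≡ rpad y) ⊎ (r ≡ one ∷ [] × rpad y ≡ [])

LeftPad-≥ : ∀ {l y} → LeftPad l y → weight (lpad y) ≤ weight l
LeftPad-≥ (inj₁ refl) = ≤-refl
LeftPad-≥ (inj₂ (refl , e)) rewrite e = z≤n

RightPad-≥ : ∀ {r} y → RightPad r y → weight (rpad y) ≤ weight r
RightPad-≥ y (inj₁ refl) = ≤-refl
RightPad-≥ y (inj₂ (refl , e)) rewrite e = z≤n

LeftPad-tight : ∀ {l y} → LeftPad l y → weight l ≡ weight (lpad y) → l ≡ lpad y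
LeftPad-tight (inj₁ e) _ = e
LeftPad-tight (inj₂ (refl , e)) h rewrite e with () ← h

RightPad-tight : ∀ {r} y → RightPad r y → weight r ≡ weight (rpad y) → r ≡ rpad y
RightPad-tight y (inj₁ e) _ = e
RightPad-tight y (inj₂ (refl , e)) h rewrite e with () ← h

right-shape : ∀ d1 y → y ≢ [] → dropLastOne d1 ≡ y → ∃ λ r → d1 ≡ y ++ r × RightPad r y
right-shape d1 y ne eq with initLast d1
... | [] = ⊥-elim (ne (sym eq))
... | e ∷ʳ′ one rewrite dropLastOne-∷ʳ-one e with refl ← eq = one ∷ [] , refl , one-pad (rpad-cases e)
  where
  one-pad : rpad e ≡ [] ⊎ rpad e ≡ one ∷ [] → RightPad (one ∷ []) e
  one-pad (inj₁ x) = inj₂ (refl , x)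
  one-pad (inj₂ x) = inj₁ (sym x)
... | e ∷ʳ′ two rewrite dropLastOne-∷ʳ-two e with refl ← eq = [] , sym (++-identityʳ _) , inj₁ (sym (rpad-∷ʳ-two e))

primitive-shape : ∀ d y → y ≢ [] → dropLastOne (dropFirstOne d) ≡ y →
        ∃₂ λ l r → d ≡ l ++ y ++ r × LeftPad l y × RightPad r y
primitive-shape [] y ne eq = ⊥-elim (ne (sym eq))
primitive-shape (one ∷ d1) y ne eq with right-shape d1 y ne eq
... | r , refl , rp = one ∷ [] , r , refl , one-pad (lpad-cases y) , rp
  where
  one-pad : lpad y ≡ [] ⊎ lpad y ≡ one ∷ [] → LeftPad (one ∷ []) y
  one-pad (inj₁ x) = inj₂ (refl , x)
  one-pad (inj₂ x) = inj₁ (sym x)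
primitive-shape (two ∷ t) y ne eq with right-shape (two ∷ t) y ne eq
... | r , e , rp = [] , r , e , inj₁ (sym (no-lpad y e)) , rp
  where
  no-lpad : ∀ y → two ∷ t ≡ y ++ r → lpad y ≡ []
  no-lpad [] _ = refl
  no-lpad (two ∷ y) _ = refl

primitive-length : ∀ x t y d → Δ (x ∷ t) ≡ just d → ∀ l r → d ≡ l ++ y ++ r →
  length (x ∷ t) ≡ weight l + (weight y + weight r)
primitive-length x t y d eΔ l r refl =
  trans (length-via-Δ x t _ eΔ) (trans (weight-++ l (y ++ r)) (cong (weight l +_) (weight-++ y r)))

primitive-length-≥ : ∀ v y → y ≢ [] → D v ≡ just y → weight (pad y) ≤ length v
primitive-length-≥ [] y ne eq = ⊥-elim (ne (sym (just-injective eq)))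
primitive-length-≥ (x ∷ v) y ne eq with D-defined (x ∷ v) y eq
... | d , eΔ , dd with primitive-shape d y ne dd
... | l , r , e , lp , rp =
  subst₂ _≤_ (sym (weight-pad y)) (sym (primitive-length x v y d eΔ l r e))
    (+-mono-≤ (LeftPad-≥ lp) (+-monoʳ-≤ (weight y) (RightPad-≥ y rp)))

sum-≤-forces-equal : ∀ a a' b b' Y → a ≤ a' → b ≤ b' → a' + (Y + b') ≤ a + (Y + b) → a ≡ a' × b ≡ b'
sum-≤-forces-equal a a' b b' Y p q h with m≤n⇒m<n∨m≡n p
... | inj₁ lt = ⊥-elim (n≮n _ (≤-trans (+-mono-<-≤ lt (+-monoʳ-≤ Y q)) h))
... | inj₂ refl with m≤n⇒m<n∨m≡n q
... | inj₁ lt = ⊥-elim (n≮n _ (≤-trans (+-mono-≤-< p (+-monoʳ-< Y lt)) h))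
... | inj₂ refl = refl , refl

shortest-primitive-Δ : ∀ x y → y ≢ [] → D x ≡ just y → (∀ v → D v ≡ just y → length x ≤ length v) → Δ x ≡ just (pad y)
shortest-primitive-Δ [] y ne eq _ = ⊥-elim (ne (sym (just-injective eq)))
shortest-primitive-Δ (c ∷ t) y ne eq shortest with D-defined (c ∷ t) y eq
... | d , eΔ , dd with primitive-shape d y ne dd
... | l , r , e , lp , rp with sum-≤-forces-equal _ _ _ _ (weight y) (LeftPad-≥ lp) (RightPad-≥ y rp) no-longer
  where
  no-longer : weight l + (weight y + weight r) ≤ weight (lpad y) + (weight y + weight (rpad y))
  no-longer = subst₂ _≤_ (primitive-length c t y d eΔ l r e) (trans (length-decode c (pad y)) (weight-pad y))
                (shortest (decode c (pad y)) (D-decode-pad c y ne))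
... | e1 , e2 = trans eΔ (cong just (trans e
                  (cong₂ (λ a b → a ++ y ++ b) (LeftPad-tight lp (sym e1)) (RightPad-tight y rp (sym e2)))))

-- Prefixes lift along derivatives.  If a's encoding is pad y, b is a
-- primitive of some extension z of y, a and b start with the same letter, and
-- b does not begin with a single letter where z begins with 2 (a condition
-- read off from the left frontier), then a is a prefix of b.

-- RunPrefix e d: decoding e from any letter gives a prefix of decoding d; a
-- final run 1 may be extended to a run 2.
data RunPrefix : List Sym → List Sym → Set where
  rp[] : ∀ {d} → RunPrefix [] d
  rp∷ : ∀ {x e d} → RunPrefix e d → RunPrefix (x ∷ e) (x ∷ d)
  rp12 : ∀ {d} → RunPrefix (one ∷ []) (two ∷ d)

RunPrefix-++ : ∀ A {e d} → RunPrefix e d → RunPrefix (A ++ e) (A ++ d)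
RunPrefix-++ [] p = p
RunPrefix-++ (x ∷ A) p = rp∷ (RunPrefix-++ A p)

decode-RunPrefix : ∀ {e d} → RunPrefix e d → ∀ c → IsPrefix (decode c e) (decode c d)
decode-RunPrefix (rp[] {d}) c = decode c d , refl
decode-RunPrefix (rp∷ {x} {e} {d} p) c with decode-RunPrefix p (other c)
... | s , eq = s , trans (++-assoc (run x c) (decode (other c) e) s) (cong (run x c ++_) eq)
decode-RunPrefix (rp12 {d}) c = c ∷ decode (other c) d , refl

DoubledStart : List Sym → List Sym → Set
DoubledStart b z = ∀ t → z ≡ two ∷ t → ∃₂ λ c t' → b ≡ c ∷ c ∷ t'

runsFrom-head : ∀ x n ys → ∃₂ λ m ms → runsFrom x n ys ≡ m ∷ ms × n ≤ m
runsFrom-head x n [] = n , [] , refl , ≤-refl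
runsFrom-head one n (one ∷ ys) with runsFrom-head one (suc n) ys
... | m , ms , e , p = m , ms , e , ≤-trans (n≤1+n n) p
runsFrom-head one n (two ∷ ys) = n , _ , refl , ≤-refl
runsFrom-head two n (one ∷ ys) = n , _ , refl , ≤-refl
runsFrom-head two n (two ∷ ys) with runsFrom-head two (suc n) ys
... | m , ms , e , p = m , ms , e , ≤-trans (n≤1+n n) p

Δ-doubled-start : ∀ c t d → Δ (c ∷ c ∷ t) ≡ just d → ∃ λ d' → d ≡ two ∷ d'
Δ-doubled-start c t d e with runsFrom-head c 2 t
... | m , ms , e2 , p = first-run-two d (trans (sym e2) (trans (sym (runs-doubled c)) (allToSym-inverse _ d e)))
  where
  runs-doubled : ∀ c → runs (c ∷ c ∷ t) ≡ runsFrom c 2 t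
  runs-doubled one = refl
  runs-doubled two = refl
  first-run-two : ∀ d → m ∷ ms ≡ map runLength d → ∃ λ d' → d ≡ two ∷ d'
  first-run-two (two ∷ d) q = d , refl
  first-run-two (one ∷ d) q with refl ← proj₁ (∷-injective q) = ⊥-elim (n≮n 1 p)

prefix-nonempty : ∀ {y z : List Sym} → y ≢ [] → IsPrefix y z → z ≢ []
prefix-nonempty {[]} ne _ = ⊥-elim (ne refl)
prefix-nonempty {x ∷ y} ne (s , refl) ()

-- Under DoubledStart the optional left 1 cannot occur, so the left pad of b
-- is the forced one.
left-pad-forced : ∀ l r y s0 b → y ≢ [] → LeftPad l (y ++ s0) → DoubledStart b (y ++ s0) →
  Δ b ≡ just (l ++ (y ++ s0) ++ r) → l ≡ lpad y
left-pad-forced l r y s0 b ne (inj₁ e) doubled eΔ = trans e (lpad-++ y s0 ne)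
left-pad-forced .(one ∷ []) r [] s0 b ne (inj₂ (refl , e)) doubled eΔ = ⊥-elim (ne refl)
left-pad-forced .(one ∷ []) r (two ∷ y') s0 b ne (inj₂ (refl , e)) doubled eΔ
  with c , t' , refl ← doubled _ refl with () ← Δ-doubled-start c t' _ eΔ

right-pad-RunPrefix : ∀ y s0 r → RightPad r (y ++ s0) → RunPrefix (rpad y) (s0 ++ r)
right-pad-RunPrefix y s0 r rp with rpad-cases y | s0
... | inj₁ e | _ rewrite e = rp[]
... | inj₂ e | one ∷ _ rewrite e = rp∷ rp[]
... | inj₂ e | two ∷ _ rewrite e = rp12
right-pad-RunPrefix y s0 r (inj₁ e') | inj₂ e | [] rewrite e' | ++-identityʳ y | e = rp∷ rp[]
right-pad-RunPrefix y s0 r (inj₂ (_ , e')) | inj₂ e | [] rewrite ++-identityʳ y with () ← trans (sym e) e'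

prefix-lifts : ∀ a b y z → y ≢ [] → IsPrefix y z → Δ a ≡ just (pad y) → D b ≡ just z →
     at a 0 ≡ at b 0 → DoubledStart b z → IsPrefix a b
prefix-lifts [] b y z ne pz ea eb h doubled = ⊥-elim (pad-nonempty y ne (sym (just-injective ea)))
prefix-lifts (ca ∷ ta) [] y z ne pz ea eb h doubled = ⊥-elim (prefix-nonempty ne pz (sym (just-injective eb)))
prefix-lifts (ca ∷ ta) (cb ∷ tb) y z ne (s0 , refl) ea eb refl doubled with D-defined (ca ∷ tb) (y ++ s0) eb
... | db , eΔb , ddb with primitive-shape db (y ++ s0) (prefix-nonempty ne (s0 , refl)) ddb
... | l , r , refl , lp , rp =
  subst₂ IsPrefix (sym (decode-Δ ca ta _ ea)) (sym (decode-Δ ca tb _ eΔb)) (decode-RunPrefix run-prefix ca)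
  where
  run-prefix : RunPrefix (pad y) (l ++ (y ++ s0) ++ r)
  run-prefix rewrite left-pad-forced l r y s0 (ca ∷ tb) ne lp doubled eΔb | ++-assoc y s0 r =
    RunPrefix-++ (lpad y) (RunPrefix-++ y (right-pad-RunPrefix y s0 r rp))

prefix-tower : ∀ n (la lb : ℕ → List Sym) →
  (∀ j → j ≤ n → la j ≢ []) →
  IsPrefix (la n) (lb n) →
  (∀ j → j < n → Δ (la j) ≡ just (pad (la (suc j)))) →
  (∀ j → j < n → D (lb j) ≡ just (lb (suc j))) →
  (∀ j → j < n → at (la j) 0 ≡ at (lb j) 0) →
  (∀ j → j < n → DoubledStart (lb j) (lb (suc j))) →
  ∀ i → i ≤ n → IsPrefix (la i) (lb i)
prefix-tower zero la lb nonempty top shortest derivative same-first doubled zero z≤n = top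
prefix-tower (suc n) la lb nonempty top shortest derivative same-first doubled = every-level
  where
  above : ∀ i → i ≤ n → IsPrefix (la (suc i)) (lb (suc i))
  above = prefix-tower n (λ j → la (suc j)) (λ j → lb (suc j)) (λ j q → nonempty (suc j) (s≤s q)) top
         (λ j q → shortest (suc j) (s≤s q)) (λ j q → derivative (suc j) (s≤s q)) (λ j q → same-first (suc j) (s≤s q)) (λ j q → doubled (suc j) (s≤s q))
  every-level : ∀ i → i ≤ suc n → IsPrefix (la i) (lb i)
  every-level zero _ = prefix-lifts (la 0) (lb 0) (la 1) (lb 1) (nonempty 1 (s≤s z≤n)) (above 0 z≤n)
    (shortest 0 (s≤s z≤n)) (derivative 0 (s≤s z≤n)) (same-first 0 (s≤s z≤n)) (doubled 0 (s≤s z≤n))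
  every-level (suc i) (s≤s q) = above i q

-- Occurrences descend along derivatives.  If decode b (pad M) occurs in
-- decode c (pad W) at offset P, then M occurs in W, at an offset P' whose
-- decoding (after the left padding of W) is P, or P followed by b when the
-- leading run of pad M is a 1 glued to the preceding letter.

decode-head : ∀ c δ x t → decode c δ ≡ x ∷ t → x ≡ c
decode-head c (one ∷ δ) .c .(decode (other c) δ) refl = refl
decode-head c (two ∷ δ) .c ._ refl = refl

decode-other-head : ∀ c δ t → decode (other c) δ ≡ c ∷ t → ⊥
decode-other-head c δ t e = other-≢ c (sym (decode-head (other c) δ c t e))

decode-∷-head : ∀ c b y S → ∃ λ t → decode c (b ∷ y) ++ S ≡ c ∷ t
decode-∷-head c one y S = _ , refl
decode-∷-head c two y S = _ , refl

decode-++-head : ∀ b d S → d ≢ [] → ∃ λ t → decode b d ++ S ≡ b ∷ t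
decode-++-head b [] S ne = ⊥-elim (ne refl)
decode-++-head b (r ∷ d) S ne = decode-∷-head b r d S

occurrence-at-start : ∀ c δ S y → y ≢ [] → decode c δ ≡ decode c (y ++ rpad y) ++ S →
      ∃ λ δ2 → δ ≡ y ++ δ2 × (rpad y ≡ one ∷ [] → δ2 ≢ [])

occurrence-at-start-step : ∀ c δ' S a b y' → decode (other c) δ' ≡ decode (other c) ((b ∷ y') ++ rpad (a ∷ b ∷ y')) ++ S →
   ∃ λ δ2 → a ∷ δ' ≡ (a ∷ b ∷ y') ++ δ2 × (rpad (a ∷ b ∷ y') ≡ one ∷ [] → δ2 ≢ [])
occurrence-at-start-step c δ' S a b y' e
  with δ2 , refl , q ← occurrence-at-start (other c) δ' S (b ∷ y') (λ ())
                         (subst (λ z → decode (other c) δ' ≡ decode (other c) ((b ∷ y') ++ z) ++ S) (rpad-++ (a ∷ []) (b ∷ y') (λ ())) e)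
  = δ2 , refl , λ h → q (trans (sym (rpad-++ (a ∷ []) (b ∷ y') (λ ()))) h)

occurrence-at-start c δ S [] ne eq = ⊥-elim (ne refl)
occurrence-at-start c (two ∷ δ') S (two ∷ []) ne refl = δ' , refl , λ ()
occurrence-at-start c (one ∷ δ') S (two ∷ []) ne eq = ⊥-elim (decode-other-head c δ' _ (proj₂ (∷-injective eq)))
occurrence-at-start c (one ∷ r ∷ δ') S (one ∷ []) ne eq = r ∷ δ' , refl , (λ _ ())
occurrence-at-start c (two ∷ δ') S (one ∷ []) ne eq = ⊥-elim (other-≢ c (sym (proj₁ (∷-injective (proj₂ (∷-injective eq))))))
occurrence-at-start c (one ∷ δ') S (one ∷ b ∷ y') ne eq = occurrence-at-start-step c δ' S one b y' (proj₂ (∷-injective eq))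
occurrence-at-start c (two ∷ δ') S (two ∷ b ∷ y') ne eq = occurrence-at-start-step c δ' S two b y' (proj₂ (∷-injective (proj₂ (∷-injective eq))))
occurrence-at-start c (one ∷ δ') S (two ∷ b ∷ y') ne eq = ⊥-elim (decode-other-head c δ' _ (proj₂ (∷-injective eq)))
occurrence-at-start c (two ∷ δ') S (one ∷ b ∷ y') ne eq with t , ht ← decode-∷-head (other c) b (y' ++ rpad (one ∷ b ∷ y')) S
  = ⊥-elim (other-≢ c (sym (proj₁ (∷-injective (trans (proj₂ (∷-injective eq)) ht)))))

OccurrenceSplit : Sym → List Sym → List Sym → Sym → List Sym → Set
OccurrenceSplit c δ P b y = ∃₂ λ δ1 δ2 → δ ≡ δ1 ++ y ++ δ2 × (rpad y ≡ one ∷ [] → δ2 ≢ []) ×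
    (lpad y ≡ [] → P ≡ decode c δ1) × (lpad y ≡ one ∷ [] → P ++ b ∷ [] ≡ decode c δ1)

occurrence-in-decode : ∀ c δ P S b y → y ≢ [] → decode c δ ≡ P ++ decode b (pad y) ++ S → OccurrenceSplit c δ P b y
occurrence-in-decode c [] P S b y ne eq = ⊥-elim (++-nonemptyʳ P _ (++-nonemptyˡ (decode b (pad y)) S (decode-nonempty b (pad y) (pad-nonempty y ne))) (sym eq))
occurrence-in-decode c (r ∷ δ') [] S b [] ne eq = ⊥-elim (ne refl)
occurrence-in-decode c (r ∷ δ') [] S b (two ∷ t) ne eq
  with refl ← decode-head c (r ∷ δ') b _ (trans eq (proj₂ (decode-∷-head b two (t ++ rpad (two ∷ t)) S)))
  with δ2 , e , q ← occurrence-at-start c (r ∷ δ') S (two ∷ t) ne eq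
  = [] , δ2 , e , q , (λ _ → refl) , λ ()
occurrence-in-decode c (one ∷ δ') [] S b (one ∷ t) ne eq with refl ← proj₁ (∷-injective eq)
  with δ2 , e , q ← occurrence-at-start (other c) δ' S (one ∷ t) ne (proj₂ (∷-injective eq))
  = one ∷ [] , δ2 , cong (one ∷_) e , q , (λ ()) , λ _ → refl
occurrence-in-decode c (two ∷ δ') [] S b (one ∷ t) ne eq with refl ← proj₁ (∷-injective eq)
  = ⊥-elim (other-≢ c (sym (proj₁ (∷-injective (proj₂ (∷-injective eq))))))
occurrence-in-decode c (one ∷ δ') (p ∷ P') S b y ne eq with refl ← proj₁ (∷-injective eq)
  with δ1 , δ2 , e , q , h1 , h2 ← occurrence-in-decode (other c) δ' P' S b y ne (proj₂ (∷-injective eq))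
  = one ∷ δ1 , δ2 , cong (one ∷_) e , q , (λ z → cong (c ∷_) (h1 z)) , λ z → cong (c ∷_) (h2 z)
occurrence-in-decode c (two ∷ δ') (p ∷ []) S b y ne eq with refl ← proj₁ (∷-injective eq) = inside-run y ne (proj₂ (∷-injective eq))
  where
  -- the occurrence starts in the middle of the first run 2 of δ
  inside-run : ∀ y → y ≢ [] → c ∷ decode (other c) δ' ≡ decode b (pad y) ++ S → OccurrenceSplit c (two ∷ δ') (c ∷ []) b y
  inside-run [] ne _ = ⊥-elim (ne refl)
  inside-run (two ∷ t) ne e with refl ← proj₁ (∷-injective e) = ⊥-elim (decode-other-head c δ' _ (proj₂ (∷-injective e)))
  inside-run (one ∷ t) ne e with refl ← proj₁ (∷-injective e)
    with δ2 , e' , q ← occurrence-at-start (other c) δ' S (one ∷ t) ne (proj₂ (∷-injective e))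
    = two ∷ [] , δ2 , cong (two ∷_) e' , q , (λ ()) , λ _ → refl
occurrence-in-decode c (two ∷ δ') (p ∷ p' ∷ P'') S b y ne eq
  with refl ← proj₁ (∷-injective eq) | refl ← proj₁ (∷-injective (proj₂ (∷-injective eq)))
  with δ1 , δ2 , e , q , h1 , h2 ← occurrence-in-decode (other c) δ' P'' S b y ne (proj₂ (∷-injective (proj₂ (∷-injective eq))))
  = two ∷ δ1 , δ2 , cong (two ∷_) e , q , (λ z → cong (λ w → c ∷ c ∷ w) (h1 z)) , λ z → cong (λ w → c ∷ c ∷ w) (h2 z)

occurrence-in-rpad : ∀ W δ1 M δ2 → W ++ rpad W ≡ δ1 ++ M ++ δ2 → M ≢ [] → (rpad M ≡ one ∷ [] → δ2 ≢ []) →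
  ∃ λ S' → W ≡ δ1 ++ M ++ S'
occurrence-in-rpad W δ1 M δ2 e ne q with rpad-cases W
... | inj₁ r0 rewrite r0 = δ2 , trans (sym (++-identityʳ W)) e
... | inj₂ r1 rewrite r1 with initLast δ2
... | δ2' ∷ʳ′ x = δ2' , ∷ʳ-injectiveˡ W (δ1 ++ M ++ δ2')
        (trans e (trans (cong (δ1 ++_) (sym (++-assoc M δ2' (x ∷ [])))) (sym (++-assoc δ1 (M ++ δ2') (x ∷ [])))))
... | [] with initLast M
... | [] = ⊥-elim (ne refl)
... | M' ∷ʳ′ x with refl ← ∷ʳ-injectiveʳ W (δ1 ++ M') (trans e (trans (cong (δ1 ++_) (++-identityʳ (M' ∷ʳ x))) (sym (++-assoc δ1 M' (x ∷ [])))))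
  = ⊥-elim (q (rpad-∷ʳ-one M') refl)

occurrence-in-pad : ∀ W δ1 M δ2 → pad W ≡ δ1 ++ M ++ δ2 → M ≢ [] → (lpad M ≡ one ∷ [] → δ1 ≢ []) → (rpad M ≡ one ∷ [] → δ2 ≢ []) →
     ∃₂ λ P' S' → W ≡ P' ++ M ++ S' × δ1 ≡ lpad W ++ P'
occurrence-in-pad [] δ1 M δ2 e ne ql qr = ⊥-elim (++-nonemptyʳ δ1 (M ++ δ2) (++-nonemptyˡ M δ2 ne) (sym e))
occurrence-in-pad (two ∷ t) δ1 M δ2 e ne ql qr with S' , eW ← occurrence-in-rpad (two ∷ t) δ1 M δ2 e ne qr = δ1 , S' , eW , refl
occurrence-in-pad (one ∷ t) [] M δ2 e ne ql qr = ⊥-elim (ql (starts-with-one M ne e) refl)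
  where
  starts-with-one : ∀ M → M ≢ [] → one ∷ (one ∷ t) ++ rpad (one ∷ t) ≡ M ++ δ2 → lpad M ≡ one ∷ []
  starts-with-one [] ne' _ = ⊥-elim (ne' refl)
  starts-with-one (x ∷ M) _ e' with refl , _ ← ∷-injective e' = refl
occurrence-in-pad (one ∷ t) (x ∷ δ1') M δ2 e ne ql qr with refl , e' ← ∷-injective e
  with S' , eW ← occurrence-in-rpad (one ∷ t) δ1' M δ2 e' ne qr = δ1' , S' , eW , refl

occurrence-descends : ∀ c W' M' P S b → M' ≢ [] → P ++ decode b (pad M') ++ S ≡ decode c (pad W') →
   ∃₂ λ P' S' → W' ≡ P' ++ M' ++ S' × (lpad M' ≡ [] → P ≡ decode c (lpad W' ++ P')) ×
                (lpad M' ≡ one ∷ [] → P ++ b ∷ [] ≡ decode c (lpad W' ++ P'))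
occurrence-descends c W' M' P S b ne eq
  with δ1 , δ2 , e , q , h1 , h2 ← occurrence-in-decode c (pad W') P S b M' ne (sym eq)
  with P' , S' , eW , refl ← occurrence-in-pad W' δ1 M' δ2 e ne
         (λ l1 d0 → ++-nonemptyʳ P (b ∷ []) (λ ()) (trans (h2 l1) (cong (decode c) d0))) q
  = P' , S' , eW , h1 , h2

occurrence-at-root : ∀ x b a P S → P ++ decode b (pad (a ∷ [])) ++ S ≡ decode x (one ∷ two ∷ []) →
  P ≡ x ∷ [] × a ≡ two × b ≡ other x
occurrence-at-root x b a P S eq with occurrence-in-decode x (one ∷ two ∷ []) P S b (a ∷ []) (λ ()) (sym eq)
occurrence-at-root x b one P S eq | δ1 , δ2 , e , q , h1 , h2 =
  ⊥-elim (no-one-inside δ1 e (λ d0 → ++-nonemptyʳ P (b ∷ []) (λ ()) (trans (h2 refl) (cong (decode x) d0))) (q refl))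
  where
  no-one-inside : ∀ δ1 → one ∷ two ∷ [] ≡ δ1 ++ one ∷ δ2 → δ1 ≢ [] → δ2 ≢ [] → ⊥
  no-one-inside [] _ n1 _ = n1 refl
  no-one-inside (u ∷ []) e _ n2 with () ← proj₂ (∷-injective e)
  no-one-inside (u ∷ v ∷ δ) e _ _ = ++-nonemptyʳ δ (one ∷ δ2) (λ ()) (sym (proj₂ (∷-injective (proj₂ (∷-injective e)))))
occurrence-at-root x b two P S eq | δ1 , δ2 , e , q , h1 , h2 with two-after-one δ1 e
  where
  two-after-one : ∀ δ1 → one ∷ two ∷ [] ≡ δ1 ++ two ∷ δ2 → δ1 ≡ one ∷ []
  two-after-one (u ∷ []) e with refl , _ ← ∷-injective e = refl
  two-after-one (u ∷ v ∷ δ) e = ⊥-elim (++-nonemptyʳ δ (two ∷ δ2) (λ ()) (sym (proj₂ (∷-injective (proj₂ (∷-injective e))))))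
... | refl with refl ← h1 refl = refl , refl , proj₁ (∷-injective (proj₂ (∷-injective eq)))

suffix-∷ʳ : ∀ {A : Set} (X Y Q : List A) b → X ++ Y ≡ Q ∷ʳ b → Y ≢ [] → ∃ λ Q' → Y ≡ Q' ∷ʳ b
suffix-∷ʳ X Y Q b e ne with initLast Y
... | [] = ⊥-elim (ne refl)
... | Y' ∷ʳ′ y with refl ← ∷ʳ-injectiveʳ (X ++ Y') Q (trans (++-assoc X Y' (y ∷ [])) e) = Y' , refl

exitLetter-last : ∀ c A Q b → decode c A ≡ Q ∷ʳ b → exitLetter A c ≡ other b
exitLetter-last c [] Q b e = ⊥-elim (++-nonemptyʳ Q (b ∷ []) (λ ()) (sym e))
exitLetter-last c (one ∷ []) Q b e with refl ← ∷ʳ-injectiveʳ [] Q e = refl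
exitLetter-last c (two ∷ []) Q b e with refl ← ∷ʳ-injectiveʳ (c ∷ []) Q e = refl
exitLetter-last c (r ∷ r' ∷ A) Q b e = exitLetter-last (other c) (r' ∷ A) (proj₁ tail) b (proj₂ tail)
  where
  tail : ∃ λ Q' → decode (other c) (r' ∷ A) ≡ Q' ∷ʳ b
  tail = suffix-∷ʳ (run r c) (decode (other c) (r' ∷ A)) Q b e (decode-nonempty (other c) (r' ∷ A) (λ ()))

pad-split : ∀ P' w → pad (P' ++ w) ≡ (lpad (P' ++ w) ++ P') ++ (w ++ rpad (P' ++ w))
pad-split P' w = trans (cong (lpad (P' ++ w) ++_) (++-assoc P' w _)) (sym (++-assoc (lpad (P' ++ w)) P' _))

suffix-ascends : ∀ c b W' M' C' P' S' X P S →
  C' ≢ [] → W' ≡ P' ++ M' ++ S' → M' ≡ C' ++ X →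
  (lpad M' ≡ [] → P ≡ decode c (lpad W' ++ P')) → (lpad M' ≡ one ∷ [] → P ++ b ∷ [] ≡ decode c (lpad W' ++ P')) →
  P ++ decode b (pad M') ++ S ≡ decode c (pad W') →
  P ++ decode b (pad C') ≡ decode c (pad (P' ++ C'))
suffix-ascends c b .(P' ++ (C' ++ X) ++ S') .(C' ++ X) C' P' S' X P S ne refl refl h1 h2 occ = by-lpad (lpad-cases C')
  where
  open ≡-Reasoning
  W' : List Sym
  W' = P' ++ (C' ++ X) ++ S'
  A : List Sym
  A = lpad W' ++ P'
  lpad-W : lpad W' ≡ lpad (P' ++ C')
  lpad-W = trans (cong lpad (sym (trans (++-assoc P' C' (X ++ S')) (cong (P' ++_) (sym (++-assoc C' X S'))))))
             (lpad-++ (P' ++ C') (X ++ S') (++-nonemptyʳ P' C' ne))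
  pad-prefix : pad (P' ++ C') ≡ A ++ (C' ++ rpad C')
  pad-prefix = trans (pad-split P' C') (cong₂ (λ l r → (l ++ P') ++ C' ++ r) (sym lpad-W) (rpad-++ P' C' ne))
  pad-W : pad W' ≡ A ++ ((C' ++ X) ++ S' ++ rpad W')
  pad-W = trans (pad-split P' ((C' ++ X) ++ S')) (cong (A ++_) (++-assoc (C' ++ X) S' (rpad W')))
  lpad-M : lpad (C' ++ X) ≡ lpad C'
  lpad-M = lpad-++ C' X ne
  decode-pad-prefix : decode c (pad (P' ++ C')) ≡ decode c A ++ decode (exitLetter A c) (C' ++ rpad C')
  decode-pad-prefix = trans (cong (decode c) pad-prefix) (decode-++ c A _)
  by-lpad : lpad C' ≡ [] ⊎ lpad C' ≡ one ∷ [] → P ++ decode b (pad C') ≡ decode c (pad (P' ++ C'))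
  -- No leading 1 in pad C': the offset P decodes A exactly, and the
  -- occurrence starts with the letter following it.
  by-lpad (inj₁ l0) = trans (cong (λ u → P ++ decode b (u ++ C' ++ rpad C')) l0) (trans (cong₂ (λ u v → u ++ decode v (C' ++ rpad C')) P-decoded b-exit) (sym decode-pad-prefix))
    where
    P-decoded : P ≡ decode c A
    P-decoded = h1 (trans lpad-M l0)
    occ-runs : decode c A ++ decode b (pad (C' ++ X)) ++ S ≡ decode c A ++ decode (exitLetter A c) ((C' ++ X) ++ S' ++ rpad W')
    occ-runs = trans (cong (λ u → u ++ decode b (pad (C' ++ X)) ++ S) (sym P-decoded)) (trans occ (trans (cong (decode c) pad-W) (decode-++ c A _)))
    b-exit : b ≡ exitLetter A c
    b-exit with decode-++-head b (pad (C' ++ X)) S (pad-nonempty (C' ++ X) (++-nonemptyˡ C' X ne))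
    ... | t , ht = decode-head (exitLetter A c) ((C' ++ X) ++ S' ++ rpad W') b t (trans (sym (++-cancelˡ (decode c A) _ _ occ-runs)) ht)
  -- A leading 1 in pad C': it is glued to the last letter of P, so P ++ b
  -- decodes A and b is the last letter of that decoding.
  by-lpad (inj₂ l1) = begin
      P ++ decode b (pad C')
        ≡⟨ cong (λ u → P ++ decode b (u ++ C' ++ rpad C')) l1 ⟩
      P ++ b ∷ decode (other b) (C' ++ rpad C')
        ≡⟨ sym (++-assoc P (b ∷ []) _) ⟩
      (P ++ b ∷ []) ++ decode (other b) (C' ++ rpad C')
        ≡⟨ cong₂ (λ u v → u ++ decode v (C' ++ rpad C')) (h2 (trans lpad-M l1)) (sym (exitLetter-last c A P b (sym (h2 (trans lpad-M l1))))) ⟩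
      decode c A ++ decode (exitLetter A c) (C' ++ rpad C')
        ≡⟨ sym decode-pad-prefix ⟩
      decode c (pad (P' ++ C')) ∎

-- Compatibility of D with reversal (needed for right frontiers).

-- Run lengths of any word are positive; this makes runs invertible by decodeℕ.
data Positive : List ℕ → Set where
  p[] : Positive []
  p∷ : ∀ {n ns} → Positive ns → Positive (suc n ∷ ns)

Positive-++ : ∀ {A B} → Positive A → Positive B → Positive (A ++ B)
Positive-++ p[] q = q
Positive-++ (p∷ p) q = p∷ (Positive-++ p q)

Positive-reverse : ∀ {ns} → Positive ns → Positive (reverse ns)
Positive-reverse p[] = p[]
Positive-reverse (p∷ {n} {ns} p) = subst Positive (sym (unfold-reverse (suc n) ns)) (Positive-++ (Positive-reverse p) (p∷ p[]))

Positive-runsFrom : ∀ x n ys → Positive (runsFrom x (suc n) ys)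
Positive-runsFrom x n [] = p∷ p[]
Positive-runsFrom one n (one ∷ ys) = Positive-runsFrom one (suc n) ys
Positive-runsFrom one n (two ∷ ys) = p∷ (Positive-runsFrom two 0 ys)
Positive-runsFrom two n (one ∷ ys) = p∷ (Positive-runsFrom one 0 ys)
Positive-runsFrom two n (two ∷ ys) = Positive-runsFrom two (suc n) ys

runsFrom-replicate-decodeℕ : ∀ x m j ns → Positive ns → runsFrom x m (replicate j x ++ decodeℕ (other x) ns) ≡ (m + j) ∷ ns
runsFrom-replicate-decodeℕ x m (suc j) ns p = trans (step x) (trans (runsFrom-replicate-decodeℕ x (suc m) j ns p) (cong (_∷ ns) (sym (+-suc m j))))
  where
  step : ∀ x → runsFrom x m (replicate (suc j) x ++ decodeℕ (other x) ns) ≡ runsFrom x (suc m) (replicate j x ++ decodeℕ (other x) ns)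
  step one = refl
  step two = refl
runsFrom-replicate-decodeℕ x m zero [] p[] = cong (_∷ []) (sym (+-identityʳ m))
runsFrom-replicate-decodeℕ one m zero (suc n ∷ ns) (p∷ p) = cong₂ _∷_ (sym (+-identityʳ m)) (runsFrom-replicate-decodeℕ two 1 n ns p)
runsFrom-replicate-decodeℕ two m zero (suc n ∷ ns) (p∷ p) = cong₂ _∷_ (sym (+-identityʳ m)) (runsFrom-replicate-decodeℕ one 1 n ns p)

runs-decodeℕ : ∀ x ns → Positive ns → runs (decodeℕ x ns) ≡ ns
runs-decodeℕ x [] p[] = refl
runs-decodeℕ x (suc n ∷ ns) (p∷ p) = runsFrom-replicate-decodeℕ x 1 n ns p

otherⁿ : ℕ → Sym → Sym
otherⁿ zero a = a
otherⁿ (suc n) a = other (otherⁿ n a)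

otherⁿ-other : ∀ n a → otherⁿ n (other a) ≡ other (otherⁿ n a)
otherⁿ-other zero a = refl
otherⁿ-other (suc n) a = cong other (otherⁿ-other n a)

otherⁿ-involutive : ∀ n a → otherⁿ n (otherⁿ n a) ≡ a
otherⁿ-involutive zero a = refl
otherⁿ-involutive (suc n) a = trans (cong other (otherⁿ-other n (otherⁿ n a))) (trans (other-involutive _) (otherⁿ-involutive n a))

decodeℕ-++ : ∀ x A B → decodeℕ x (A ++ B) ≡ decodeℕ x A ++ decodeℕ (otherⁿ (length A) x) B
decodeℕ-++ x [] B = refl
decodeℕ-++ x (n ∷ A) B = trans (cong (replicate n x ++_) (trans (decodeℕ-++ (other x) A B) (cong (λ z → decodeℕ (other x) A ++ decodeℕ z B) (otherⁿ-other (length A) x))))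
                             (sym (++-assoc (replicate n x) (decodeℕ (other x) A) _))

reverse-replicate : ∀ n (x : Sym) → reverse (replicate n x) ≡ replicate n x
reverse-replicate zero x = refl
reverse-replicate (suc n) x = trans (unfold-reverse x (replicate n x)) (trans (cong (_++ x ∷ []) (reverse-replicate n x)) (replicate-snoc n))
  where
  replicate-snoc : ∀ n → replicate n x ∷ʳ x ≡ x ∷ replicate n x
  replicate-snoc n = trans (replicate-++-∷ n x []) (cong (x ∷_) (++-identityʳ _))

reverse-decodeℕ : ∀ x ns → reverse (decodeℕ x ns) ≡ decodeℕ (otherⁿ (length ns) (other x)) (reverse ns)
reverse-decodeℕ x [] = refl
reverse-decodeℕ x (n ∷ ns) = begin
    reverse (replicate n x ++ decodeℕ (other x) ns)
      ≡⟨ reverse-++ (replicate n x) (decodeℕ (other x) ns) ⟩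
    reverse (decodeℕ (other x) ns) ++ reverse (replicate n x)
      ≡⟨ cong₂ _++_ (reverse-decodeℕ (other x) ns) (reverse-replicate n x) ⟩
    decodeℕ (otherⁿ k (other (other x))) (reverse ns) ++ replicate n x
      ≡⟨ cong₂ (λ a b → decodeℕ a (reverse ns) ++ replicate n b) (otherⁿ-other k (other x)) (sym last-letter-parity) ⟩
    decodeℕ z (reverse ns) ++ replicate n (otherⁿ (length (reverse ns)) z)
      ≡⟨ cong (decodeℕ z (reverse ns) ++_) (sym (++-identityʳ _)) ⟩
    decodeℕ z (reverse ns) ++ decodeℕ (otherⁿ (length (reverse ns)) z) (n ∷ [])
      ≡⟨ sym (decodeℕ-++ z (reverse ns) (n ∷ [])) ⟩
    decodeℕ z (reverse ns ++ n ∷ [])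
      ≡⟨ cong (decodeℕ z) (sym (unfold-reverse n ns)) ⟩
    decodeℕ z (reverse (n ∷ ns)) ∎
  where
  open ≡-Reasoning
  k : ℕ
  k = length ns
  z : Sym
  z = other (otherⁿ k (other x))
  last-letter-parity : otherⁿ (length (reverse ns)) z ≡ x
  last-letter-parity = trans (cong (λ m → otherⁿ m z) (length-reverse ns))
           (trans (cong (otherⁿ k) (sym (otherⁿ-other k (other x)))) (trans (otherⁿ-involutive k (other (other x))) (other-involutive x)))

runs-reverse : ∀ w → runs (reverse w) ≡ reverse (runs w)
runs-reverse [] = refl
runs-reverse (x ∷ ys) = begin
    runs (reverse (x ∷ ys))
      ≡⟨ cong (λ u → runs (reverse u)) (runsFrom-decodeℕ x 1 ys) ⟩
    runs (reverse (decodeℕ x ns))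
      ≡⟨ cong runs (reverse-decodeℕ x ns) ⟩
    runs (decodeℕ _ (reverse ns))
      ≡⟨ runs-decodeℕ _ (reverse ns) (Positive-reverse (Positive-runsFrom x 0 ys)) ⟩
    reverse ns ∎
  where
  open ≡-Reasoning
  ns : List ℕ
  ns = runsFrom x 1 ys

allToSym-reverse-just : ∀ ns d → allToSym ns ≡ just d → allToSym (reverse ns) ≡ just (reverse d)
allToSym-reverse-just ns d e rewrite allToSym-inverse ns d e | sym (reverse-map runLength d) = allToSym-runLengths (reverse d)

allToSym-reverse-nothing : ∀ ns → allToSym ns ≡ nothing → allToSym (reverse ns) ≡ nothing
allToSym-reverse-nothing ns e with allToSym (reverse ns) in e'
... | nothing = refl
... | just d' with () ← trans (sym e) (trans (cong allToSym (sym (reverse-involutive ns))) (allToSym-reverse-just (reverse ns) d' e'))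

dropLast-dropFirst-comm : ∀ d → dropLastOne (dropFirstOne d) ≡ dropFirstOne (dropLastOne d)
dropLast-dropFirst-comm [] = refl
dropLast-dropFirst-comm (one ∷ t) with initLast t
... | [] = refl
... | u ∷ʳ′ one = trans (dropLastOne-∷ʳ-one u) (sym (cong dropFirstOne (dropLastOne-∷ʳ-one (one ∷ u))))
... | u ∷ʳ′ two = trans (dropLastOne-∷ʳ-two u) (sym (cong dropFirstOne (dropLastOne-∷ʳ-two (one ∷ u))))
dropLast-dropFirst-comm (two ∷ t) with initLast t
... | [] = refl
... | u ∷ʳ′ one = trans (dropLastOne-∷ʳ-one (two ∷ u)) (sym (cong dropFirstOne (dropLastOne-∷ʳ-one (two ∷ u))))
... | u ∷ʳ′ two = trans (dropLastOne-∷ʳ-two (two ∷ u)) (sym (cong dropFirstOne (dropLastOne-∷ʳ-two (two ∷ u))))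

reverse-dropFirst : ∀ e → reverse (dropFirstOne e) ≡ dropLastOne (reverse e)
reverse-dropFirst e = cong (λ u → reverse (dropFirstOne u)) (sym (reverse-involutive e))

reverse-dropLast : ∀ e → reverse (dropLastOne e) ≡ dropFirstOne (reverse e)
reverse-dropLast e = reverse-involutive _

unpad-reverse : ∀ d → dropLastOne (dropFirstOne (reverse d)) ≡ reverse (dropLastOne (dropFirstOne d))
unpad-reverse d = sym (begin
    reverse (dropLastOne (dropFirstOne d))  ≡⟨ reverse-dropLast (dropFirstOne d) ⟩
    dropFirstOne (reverse (dropFirstOne d)) ≡⟨ cong dropFirstOne (reverse-dropFirst d) ⟩
    dropFirstOne (dropLastOne (reverse d))  ≡⟨ sym (dropLast-dropFirst-comm (reverse d)) ⟩
    dropLastOne (dropFirstOne (reverse d)) ∎)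
  where open ≡-Reasoning

D-reverse : ∀ w → D (reverse w) ≡ Maybe.map reverse (D w)
D-reverse w with allToSym (runs w) in e
... | just d = trans (D-via-Δ (reverse w) (reverse d) (trans (cong allToSym (runs-reverse w)) (allToSym-reverse-just (runs w) d e)))
                     (trans (cong just (unpad-reverse d)) (cong (Maybe.map reverse) (sym (D-via-Δ w d e))))
... | nothing = trans (D-undefined (reverse w) (trans (cong allToSym (runs-reverse w)) (allToSym-reverse-nothing (runs w) e)))
                      (cong (Maybe.map reverse) (sym (D-undefined w e)))

-- Towers, heights and left frontiers.

Tower : List Sym → (ℕ → List Sym) → Set
Tower w lv = ∀ j → Dⁿ j w ≡ just (lv j)

tower : ∀ {w} → C∞ w → ℕ → List Sym
tower c j = proj₁ (c j)

tower-ok : ∀ {w} (c : C∞ w) → Tower w (tower c)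
tower-ok c j = proj₂ (c j)

Tower-D : ∀ {w lv} → Tower w lv → ∀ j → D (lv j) ≡ just (lv (suc j))
Tower-D {w} {lv} L j = trans (sym (cong (_>>= D) (L j))) (L (suc j))

Tower-base : ∀ {w lv} → Tower w lv → lv 0 ≡ w
Tower-base L = sym (just-injective (L 0))

Tower-intro : ∀ w (lv : ℕ → List Sym) → lv 0 ≡ w → (∀ j → D (lv j) ≡ just (lv (suc j))) → Tower w lv
Tower-intro w lv base closed zero = cong just (sym base)
Tower-intro w lv base closed (suc j) rewrite Tower-intro w lv base closed j = closed j

Tower-C∞ : ∀ {w lv} → Tower w lv → C∞ w
Tower-C∞ {lv = lv} L j = lv j , L j

Tower-reverse : ∀ {w lv} → Tower w lv → Tower (reverse w) (λ j → reverse (lv j))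
Tower-reverse {w} {lv} L = Tower-intro (reverse w) (λ j → reverse (lv j)) (cong reverse (Tower-base L))
  (λ j → trans (D-reverse (lv j)) (cong (Maybe.map reverse) (Tower-D L j)))

height-empty : ∀ {w lv k} → Tower w lv → Height w k → lv k ≡ []
height-empty L (h , _) = just-injective (trans (sym (L _)) h)

below-height-nonempty : ∀ {w lv k} → Tower w lv → Height w k → ∀ j → j < k → lv j ≢ []
below-height-nonempty L (_ , h) j p e = h j p (trans (L j) (cong just e))

height-intro : ∀ {w lv k} → Tower w lv → lv k ≡ [] → (∀ j → j < k → lv j ≢ []) → Height w k
height-intro L e ne = trans (L _) (cong just e) , λ j p e' → ne j p (just-injective (trans (sym (L j)) e'))

height-unique : ∀ {w a b} → Height w a → Height w b → a ≡ b
height-unique {w} {a} {b} (ha , na) (hb , nb) with <-cmp a b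
... | tri< p _ _ = ⊥-elim (nb a p ha)
... | tri≈ _ e _ = e
... | tri> _ _ p = ⊥-elim (na b p hb)

reverse-nonempty : ∀ (v : List Sym) → v ≢ [] → reverse v ≢ []
reverse-nonempty v ne e = ne (trans (sym (reverse-involutive v)) (cong reverse e))

height-reverse : ∀ {w lv k} → Tower w lv → Height w k → Height (reverse w) k
height-reverse {w} {lv} {k} L H = height-intro (Tower-reverse L) (cong reverse (height-empty L H)) (λ j p → reverse-nonempty (lv j) (below-height-nonempty L H j p))

frontierEntry : List Sym → List Sym → Sym0
frontierEntry (x ∷ y ∷ _) (b ∷ _) = entry x y b
frontierEntry _ _ = z0

AtLeastTwo : List Sym → Set
AtLeastTwo a = ∃ λ x → ∃ λ y → ∃ λ t → a ≡ x ∷ y ∷ t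

D-defined-long : ∀ a b → D a ≡ just b → b ≢ [] → AtLeastTwo a
D-defined-long [] b e ne = ⊥-elim (ne (sym (just-injective e)))
D-defined-long (x ∷ []) b e ne = ⊥-elim (ne (sym (just-injective e)))
D-defined-long (x ∷ y ∷ t) b e ne = x , y , t , refl

psiEntry-frontierEntry : ∀ a b → AtLeastTwo a → b ≢ [] → psiEntry a b ≡ just (frontierEntry a b)
psiEntry-frontierEntry .(x ∷ y ∷ t) [] (x , y , t , refl) ne = ⊥-elim (ne refl)
psiEntry-frontierEntry .(x ∷ y ∷ t) (b ∷ _) (x , y , t , refl) ne = refl

at-0-emb : ∀ v → v ≢ [] → Maybe.map emb (at v 0) ≡ just (emb (first v))
at-0-emb [] ne = ⊥-elim (ne refl)
at-0-emb (x ∷ v) ne = refl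

Tower-long : ∀ {w lv k} → Tower w lv → Height w k → ∀ m → suc m < k → AtLeastTwo (lv m)
Tower-long L H m p = D-defined-long _ _ (Tower-D L m) (below-height-nonempty L H (suc m) p)

leftFrontier-intro : ∀ w lv k F → Tower w lv → Height w k → 0 < k → length F ≡ k →
  at F 0 ≡ just (emb (first (lv 0))) → (∀ m → suc m < k → at F (suc m) ≡ just (frontierEntry (lv m) (lv (suc m)))) → LeftFrontier w F
leftFrontier-intro w lv k F L H positive length-F start entries = Tower-C∞ L , k , H , positive , length-F , start-ok , entries-ok
  where
  start-ok : at F 0 ≡ Maybe.map emb (at w 0)
  start-ok = trans start (sym (subst (λ u → Maybe.map emb (at u 0) ≡ just (emb (first (lv 0)))) (Tower-base L) (at-0-emb (lv 0) (below-height-nonempty L H 0 positive))))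
  entries-ok : ∀ m a b → suc m < k → Dⁿ m w ≡ just a → Dⁿ (suc m) w ≡ just b → at F (suc m) ≡ psiEntry a b
  entries-ok m a b p ea eb rewrite just-injective (trans (sym ea) (L m)) | just-injective (trans (sym eb) (L (suc m))) =
    trans (entries m p) (sym (psiEntry-frontierEntry _ _ (Tower-long L H m p) (below-height-nonempty L H (suc m) p)))

leftFrontier-elim : ∀ w F lv → LeftFrontier w F → Tower w lv → ∃ λ k → Height w k × 0 < k × length F ≡ k ×
   at F 0 ≡ just (emb (first (lv 0))) × (∀ m → suc m < k → at F (suc m) ≡ just (frontierEntry (lv m) (lv (suc m))))
leftFrontier-elim w F lv (c , k , H , positive , length-F , start , entries) L = k , H , positive , length-F , start-ok , entries-ok
  where
  start-ok : at F 0 ≡ just (emb (first (lv 0)))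
  start-ok = trans start (subst (λ u → Maybe.map emb (at u 0) ≡ just (emb (first (lv 0)))) (Tower-base L) (at-0-emb (lv 0) (below-height-nonempty L H 0 positive)))
  entries-ok : ∀ m → suc m < k → at F (suc m) ≡ just (frontierEntry (lv m) (lv (suc m)))
  entries-ok m p = trans (entries m (lv m) (lv (suc m)) p (L m) (L (suc m))) (psiEntry-frontierEntry _ _ (Tower-long L H m p) (below-height-nonempty L H (suc m) p))

emb-injective : ∀ {a b} → emb a ≡ emb b → a ≡ b
emb-injective {one} {one} e = refl
emb-injective {two} {two} e = refl
emb-injective {one} {two} ()
emb-injective {two} {one} ()

frontierEntry-emb : ∀ a b c → frontierEntry a b ≡ emb c → AtLeastTwo a → b ≢ [] → first b ≡ c × DoubledStart a b
frontierEntry-emb .(x ∷ y ∷ t) [] c e (x , y , t , refl) ne = ⊥-elim (ne refl)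
frontierEntry-emb .(one ∷ one ∷ t) (b ∷ bs) c e (one , one , t , refl) ne = emb-injective e , λ t' _ → one , t , refl
frontierEntry-emb .(two ∷ two ∷ t) (b ∷ bs) c e (two , two , t , refl) ne = emb-injective e , λ t' _ → two , t , refl
frontierEntry-emb .(one ∷ two ∷ t) (one ∷ bs) c e (one , two , t , refl) ne = emb-injective e , λ t' ()
frontierEntry-emb .(two ∷ one ∷ t) (one ∷ bs) c e (two , one , t , refl) ne = emb-injective e , λ t' ()
frontierEntry-emb .(one ∷ two ∷ t) (two ∷ bs) one () (one , two , t , refl) ne
frontierEntry-emb .(one ∷ two ∷ t) (two ∷ bs) two () (one , two , t , refl) ne
frontierEntry-emb .(two ∷ one ∷ t) (two ∷ bs) one () (two , one , t , refl) ne
frontierEntry-emb .(two ∷ one ∷ t) (two ∷ bs) two () (two , one , t , refl) ne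

-- Shortest primitives never produce the entry 0.
frontierEntry-pad : ∀ c y → y ≢ [] → frontierEntry (decode c (pad y)) y ≡ emb (first y)
frontierEntry-pad c [] ne = ⊥-elim (ne refl)
frontierEntry-pad one (one ∷ t) ne = refl
frontierEntry-pad two (one ∷ t) ne = refl
frontierEntry-pad one (two ∷ t) ne = refl
frontierEntry-pad two (two ∷ t) ne = refl

-- Frontier entries only see the first two letters of a level and the first
-- letter of the next one, so they are stable under extension to the right.
frontierEntry-prefix : ∀ a a' b b' → AtLeastTwo a → IsPrefix a a' → at b 0 ≡ at b' 0 → frontierEntry a b ≡ frontierEntry a' b'
frontierEntry-prefix .(x ∷ y ∷ t) .((x ∷ y ∷ t) ++ s) [] [] (x , y , t , refl) (s , refl) e = refl
frontierEntry-prefix .(x ∷ y ∷ t) .((x ∷ y ∷ t) ++ s) (c ∷ _) (.c ∷ _) (x , y , t , refl) (s , refl) refl = refl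

letterAt : List Sym → ℕ → Sym
letterAt [] _ = one
letterAt (x ∷ _) zero = x
letterAt (_ ∷ xs) (suc i) = letterAt xs i

at-++ˡ : ∀ {A : Set} (xs ys : List A) i → i < length xs → at (xs ++ ys) i ≡ at xs i
at-++ˡ (x ∷ xs) ys zero p = refl
at-++ˡ (x ∷ xs) ys (suc i) (s≤s p) = at-++ˡ xs ys i p

at-++-len : ∀ {A : Set} (xs : List A) y ys → at (xs ++ y ∷ ys) (length xs) ≡ just y
at-++-len [] y ys = refl
at-++-len (x ∷ xs) y ys = at-++-len xs y ys

at-embW : ∀ U i → i < length U → at (embW U) i ≡ just (emb (letterAt U i))
at-embW (x ∷ U) zero p = refl
at-embW (x ∷ U) (suc i) (s≤s p) = at-embW U i p

length-embW : ∀ U → length (embW U) ≡ length U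
length-embW [] = refl
length-embW (x ∷ U) = cong suc (length-embW U)

frontierLetter : (ℕ → List Sym) → ℕ → Sym0
frontierLetter lv zero = emb (first (lv 0))
frontierLetter lv (suc m) = frontierEntry (lv m) (lv (suc m))

frontier : (ℕ → List Sym) → ℕ → List Sym0
frontier lv zero = []
frontier lv (suc n) = frontier lv n ++ frontierLetter lv n ∷ []

length-frontier : ∀ lv n → length (frontier lv n) ≡ n
length-frontier lv zero = refl
length-frontier lv (suc n) = trans (length-++ (frontier lv n)) (trans (+-comm (length (frontier lv n)) 1) (cong suc (length-frontier lv n)))

at-frontier : ∀ lv n i → i < n → at (frontier lv n) i ≡ just (frontierLetter lv i)
at-frontier lv (suc n) i p with m≤n⇒m<n∨m≡n p
... | inj₁ (s≤s q) = trans (at-++ˡ (frontier lv n) _ i (subst (i <_) (sym (length-frontier lv n)) q)) (at-frontier lv n i q)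
... | inj₂ refl = subst (λ j → at (frontier lv n ++ frontierLetter lv n ∷ []) j ≡ just (frontierLetter lv n)) (length-frontier lv n) (at-++-len (frontier lv n) _ [])

leftFrontier-frontier : ∀ w lv k → Tower w lv → Height w k → 0 < k → LeftFrontier w (frontier lv k)
leftFrontier-frontier w lv k L H pk = leftFrontier-intro w lv k (frontier lv k) L H pk (length-frontier lv k) (at-frontier lv k 0 pk) (λ m p → at-frontier lv k (suc m) p)

-- Lifts.  lift ρ f n is the tower obtained from the tower ρ by putting n
-- further levels below it, each the shortest primitive of the level above,
-- decoded from the prescribed first letter f j.  When ρ is a root of height
-- one, the lift is the tower of a minimal word.
lift : (ℕ → List Sym) → (ℕ → Sym) → ℕ → ℕ → List Sym
lift ρ f zero j = ρ j
lift ρ f (suc n) zero = decode (f 0) (pad (lift ρ (λ i → f (suc i)) n 0))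
lift ρ f (suc n) (suc j) = lift ρ (λ i → f (suc i)) n j

at-decode : ∀ c d → d ≢ [] → at (decode c d) 0 ≡ just c
at-decode c [] ne = ⊥-elim (ne refl)
at-decode c (one ∷ d) ne = refl
at-decode c (two ∷ d) ne = refl

module Lift (ρ : ℕ → List Sym) (ρ-D : ∀ j → D (ρ j) ≡ just (ρ (suc j))) (ρ-nonempty : ρ 0 ≢ []) where

  lift-base-nonempty : ∀ n f → lift ρ f n 0 ≢ []
  lift-base-nonempty zero f = ρ-nonempty
  lift-base-nonempty (suc n) f = decode-nonempty (f 0) _ (pad-nonempty _ (lift-base-nonempty n (λ i → f (suc i))))

  lift-D : ∀ n f j → D (lift ρ f n j) ≡ just (lift ρ f n (suc j))
  lift-D zero f j = ρ-D j
  lift-D (suc n) f zero = D-decode-pad (f 0) _ (lift-base-nonempty n (λ i → f (suc i)))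
  lift-D (suc n) f (suc j) = lift-D n (λ i → f (suc i)) j

  lift-tower : ∀ n f → Tower (lift ρ f n 0) (lift ρ f n)
  lift-tower n f = Tower-intro _ (lift ρ f n) refl (lift-D n f)

  lift-top : ∀ n f i → lift ρ f n (n + i) ≡ ρ i
  lift-top zero f i = refl
  lift-top (suc n) f i = lift-top n (λ i → f (suc i)) i

  lift-root : ∀ n f → lift ρ f n n ≡ ρ 0
  lift-root n f = trans (cong (lift ρ f n) (sym (+-identityʳ n))) (lift-top n f 0)

  lift-above-root : ∀ n f → lift ρ f n (suc n) ≡ ρ 1
  lift-above-root n f = trans (cong (lift ρ f n) (+-comm 1 n)) (lift-top n f 1)

  lift-nonempty : ∀ h → (∀ j → j < h → ρ j ≢ []) → ∀ n f j → j < n + h → lift ρ f n j ≢ []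
  lift-nonempty h ρ-ne zero f j p = ρ-ne j p
  lift-nonempty h ρ-ne (suc n) f zero p = lift-base-nonempty (suc n) f
  lift-nonempty h ρ-ne (suc n) f (suc j) (s≤s p) = lift-nonempty h ρ-ne n (λ i → f (suc i)) j p

  lift-height : ∀ h → (∀ j → j < h → ρ j ≢ []) → ρ h ≡ [] → ∀ n f → Height (lift ρ f n 0) (n + h)
  lift-height h ρ-ne ρ-empty n f = height-intro (lift-tower n f) (trans (lift-top n f h) ρ-empty) (lift-nonempty h ρ-ne n f)

  lift-step : ∀ n f j → j < n → lift ρ f n j ≡ decode (f j) (pad (lift ρ f n (suc j)))
  lift-step (suc n) f zero p = refl
  lift-step (suc n) f (suc j) (s≤s p) = lift-step n (λ i → f (suc i)) j p

  lift-Δ : ∀ n f j → j < n → Δ (lift ρ f n j) ≡ just (pad (lift ρ f n (suc j)))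
  lift-Δ n f j p rewrite lift-step n f j p = Δ-decode (f j) _

  lift-nonempty-above : ∀ n f j → j < n → lift ρ f n (suc j) ≢ []
  lift-nonempty-above (suc n) f zero p = lift-base-nonempty n (λ i → f (suc i))
  lift-nonempty-above (suc n) f (suc j) (s≤s p) = lift-nonempty-above n (λ i → f (suc i)) j p

  lift-first : ∀ n f j → j < n → at (lift ρ f n j) 0 ≡ just (f j)
  lift-first n f j p rewrite lift-step n f j p = at-decode (f j) _ (pad-nonempty _ (lift-nonempty-above n f j p))

  root-nonempty : ∀ j → j < 1 → ρ j ≢ []
  root-nonempty zero _ = ρ-nonempty
  root-nonempty (suc j) (s≤s ())

  lift-height-one : ρ 1 ≡ [] → ∀ n f → Height (lift ρ f n 0) (suc n)
  lift-height-one ρ-empty n f = subst (Height (lift ρ f n 0)) (+-comm n 1) (lift-height 1 root-nonempty ρ-empty n f)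

  lift-minimal : ∀ n f → ρ 1 ≡ [] → Minimal (lift ρ f n 0)
  lift-minimal n f ρ-empty = Tower-C∞ (lift-tower n f) , n + 1 , lift-height 1 root-nonempty ρ-empty n f ,
                              subst (1 ≤_) (+-comm 1 n) (s≤s z≤n) , shortest
    where
    shortest : ∀ j x y → suc (suc j) ≤ n + 1 → Dⁿ j (lift ρ f n 0) ≡ just x → Dⁿ (suc j) (lift ρ f n 0) ≡ just y →
           ∀ v → Primitive v y → length x ≤ length v
    shortest j x y p ex ey v pv
      rewrite just-injective (trans (sym ex) (lift-tower n f j)) | just-injective (trans (sym ey) (lift-tower n f (suc j)))
            | lift-step n f j (+-cancelʳ-≤ 1 (suc j) n (subst (_≤ n + 1) (+-comm 1 (suc j)) p))
      = subst (_≤ length v) (sym (length-decode (f j) _))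
          (primitive-length-≥ v _ (lift-nonempty 1 root-nonempty n f (suc j) p) pv)

-- The three roots used: a single letter x, the pair x x̄ (double root), and
-- x x̄ x̄, whose derivative is the single letter 2.
rootSingle : Sym → ℕ → List Sym
rootSingle x zero = x ∷ []
rootSingle x (suc _) = []

rootDouble : Sym → ℕ → List Sym
rootDouble x zero = x ∷ other x ∷ []
rootDouble x (suc _) = []

rootZero : Sym → ℕ → List Sym
rootZero x zero = x ∷ other x ∷ other x ∷ []
rootZero x (suc zero) = two ∷ []
rootZero x (suc (suc _)) = []

D-rootSingle : ∀ x j → D (rootSingle x j) ≡ just (rootSingle x (suc j))
D-rootSingle x zero = refl
D-rootSingle x (suc j) = refl

D-rootDouble : ∀ x j → D (rootDouble x j) ≡ just (rootDouble x (suc j))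
D-rootDouble one zero = refl
D-rootDouble two zero = refl
D-rootDouble x (suc j) = refl

D-rootZero : ∀ x j → D (rootZero x j) ≡ just (rootZero x (suc j))
D-rootZero one zero = refl
D-rootZero two zero = refl
D-rootZero x (suc zero) = refl
D-rootZero x (suc (suc j)) = refl

at-first : ∀ v → v ≢ [] → at v 0 ≡ just (first v)
at-first [] ne = ⊥-elim (ne refl)
at-first (x ∷ v) ne = refl

first-at : ∀ v c → at v 0 ≡ just c → first v ≡ c
first-at (x ∷ v) c refl = refl

prefix-first : ∀ (a b : List Sym) → a ≢ [] → IsPrefix a b → at a 0 ≡ at b 0
prefix-first [] b ne _ = ⊥-elim (ne refl)
prefix-first (x ∷ a) .((x ∷ a) ++ s) ne (s , refl) = refl

prefix-first-letter : ∀ (a b : List Sym) → a ≢ [] → IsPrefix a b → first a ≡ first b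
prefix-first-letter [] b ne _ = ⊥-elim (ne refl)
prefix-first-letter (x ∷ a) .((x ∷ a) ++ s) ne (s , refl) = refl

leftFrontier-prefix-tower : ∀ w lw lb k → Tower w lw → Height w (suc k) →
  (∀ j → j ≤ k → IsPrefix (lw j) (lb j)) → LeftFrontier w (frontier lb (suc k))
leftFrontier-prefix-tower w lw lb k L H pre =
  leftFrontier-intro w lw (suc k) (frontier lb (suc k)) L H (s≤s z≤n) (length-frontier lb (suc k))
    (trans (at-frontier lb (suc k) 0 (s≤s z≤n)) (cong (λ c → just (emb c)) (sym (prefix-first-letter (lw 0) (lb 0) (nonempty 0 z≤n) (pre 0 z≤n)))))
    entries
  where
  nonempty : ∀ j → j ≤ k → lw j ≢ []
  nonempty j q = below-height-nonempty L H j (s≤s q)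
  entries : ∀ m → suc m < suc k → at (frontier lb (suc k)) (suc m) ≡ just (frontierEntry (lw m) (lw (suc m)))
  entries m (s≤s q) = trans (at-frontier lb (suc k) (suc m) (s≤s q)) (cong just (sym
     (frontierEntry-prefix (lw m) (lb m) (lw (suc m)) (lb (suc m)) (Tower-long L H m (s≤s q)) (pre m (<⇒≤ q))
        (prefix-first _ _ (nonempty (suc m) q) (pre (suc m) q)))))

+-suc-≡⇒< : ∀ j n {k} → j + suc n ≡ k → j < k
+-suc-≡⇒< j n e = subst (j <_) e (m<m+n j (s≤s z≤n))

prefix-length-eq : ∀ (a b : List Sym) → IsPrefix a b → length b ≤ length a → a ≡ b
prefix-length-eq a b ([] , e) _ = trans (sym (++-identityʳ a)) e
prefix-length-eq a b (y ∷ s , e) b≤a = ⊥-elim (n≮n (length a) (≤-trans longer b≤a))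
  where
  longer : suc (length a) ≤ length b
  longer = subst (suc (length a) ≤_) (trans (sym (length-++ a)) (cong length e))
             (subst (suc (length a) ≤_) (sym (+-suc (length a) (length s))) (s≤s (m≤m+n (length a) (length s))))

decode-form : ∀ v d → v ≢ [] → Δ v ≡ just d → v ≡ decode (first v) d
decode-form [] d ne _ = ⊥-elim (ne refl)
decode-form (x ∷ v) d ne e = decode-Δ x v d e

pad-DoubledStart : ∀ b y → DoubledStart (decode b (pad y)) y
pad-DoubledStart b .(two ∷ t) t refl = b , _ , refl

MinimalityCondition : (ℕ → List Sym) → ℕ → Set
MinimalityCondition lv k = ∀ j → suc (suc j) ≤ k → ∀ v → D v ≡ just (lv (suc j)) → length (lv j) ≤ length v

Minimal→condition : ∀ w lv k → Tower w lv → Height w k → Minimal w → MinimalityCondition lv k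
Minimal→condition w lv k L H (c , k2 , H2 , _ , shortest) j p v pv =
  shortest j (lv j) (lv (suc j)) (subst (suc (suc j) ≤_) (height-unique H H2) p) (L j) (L (suc j)) v pv

condition→Minimal : ∀ w lv k → Tower w lv → Height w k → 1 ≤ k → MinimalityCondition lv k → Minimal w
condition→Minimal w lv k L H pk mc = Tower-C∞ L , k , H , pk , λ j x y p ex ey v pv →
  subst₂ (λ a b → length a ≤ length v) (just-injective (trans (sym (L j)) ex)) (just-injective (trans (sym (L (suc j))) ey))
    (mc j p v (subst (λ z → D v ≡ just z) (just-injective (trans (sym ey) (L (suc j)))) pv))

-- Minimality is invariant under reversal (primitives reverse with the word).
condition-reverse : ∀ lv k → MinimalityCondition lv k → MinimalityCondition (λ j → reverse (lv j)) k
condition-reverse lv k mc j p v pv = subst₂ _≤_ (sym (length-reverse (lv j))) (length-reverse v)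
  (mc j p (reverse v) (trans (D-reverse v) (trans (cong (Maybe.map reverse) pv) (cong just (reverse-involutive _)))))

minimal-tower-Δ : ∀ w lv k → Tower w lv → Height w k → Minimal w → ∀ j → suc (suc j) ≤ k → Δ (lv j) ≡ just (pad (lv (suc j)))
minimal-tower-Δ w lv k L H mn j p = shortest-primitive-Δ (lv j) (lv (suc j)) (below-height-nonempty L H (suc j) p) (Tower-D L j) (Minimal→condition w lv k L H mn j p)

-- Reading a frontier.
frontier-first-letters : ∀ b F (lb : ℕ → List Sym) K U → Tower b lb → LeftFrontier b F → length U ≡ suc K → suc K ≤ length F →
     (∀ i → i < suc K → at F i ≡ at (embW U) i) →
     (∀ j → j ≤ K → at (lb j) 0 ≡ just (letterAt U j)) × (∀ j → j < K → DoubledStart (lb j) (lb (suc j)))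
frontier-first-letters b F lb K U L lf length-U K<F agree with leftFrontier-elim b F lb lf L
... | hb , H , positive , length-F , start , entries = first-letters , doubled
  where
  below-height : suc K ≤ hb
  below-height = subst (suc K ≤_) length-F K<F
  index-U : ∀ i → i < suc K → i < length U
  index-U i p = subst (i <_) (sym length-U) p
  entry-above : ∀ m → suc m ≤ K → first (lb (suc m)) ≡ letterAt U (suc m) × DoubledStart (lb m) (lb (suc m))
  entry-above m p = frontierEntry-emb (lb m) (lb (suc m)) (letterAt U (suc m))
     (just-injective (trans (sym (entries m (≤-trans (s≤s p) below-height))) (trans (agree (suc m) (s≤s p)) (at-embW U (suc m) (index-U (suc m) (s≤s p))))))
     (Tower-long L H m (≤-trans (s≤s p) below-height)) (below-height-nonempty L H (suc m) (≤-trans (s≤s p) below-height))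
  first-letters : ∀ j → j ≤ K → at (lb j) 0 ≡ just (letterAt U j)
  first-letters zero _ = trans (at-first (lb 0) (below-height-nonempty L H 0 positive))
    (cong just (emb-injective (just-injective (trans (sym start) (trans (agree 0 (s≤s z≤n)) (at-embW U 0 (index-U 0 (s≤s z≤n))))))))
  first-letters (suc m) p = trans (at-first (lb (suc m)) (below-height-nonempty L H (suc m) (≤-trans (s≤s p) below-height))) (cong just (proj₁ (entry-above m p)))
  doubled : ∀ j → j < K → DoubledStart (lb j) (lb (suc j))
  doubled j p = proj₂ (entry-above j p)

at-embW-∷ʳ : ∀ U z K → length U ≡ suc K → ∀ i → i < suc K → at (embW U ++ z ∷ []) i ≡ at (embW U) i
at-embW-∷ʳ U z K lenU i p = at-++ˡ (embW U) (z ∷ []) i (subst (i <_) (sym (trans (length-embW U) lenU)) p)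

length-embW-∷ʳ : ∀ U (z : Sym0) K → length U ≡ suc K → length (embW U ++ z ∷ []) ≡ suc (suc K)
length-embW-∷ʳ U z K lenU = trans (length-++ (embW U)) (trans (cong (_+ 1) (trans (length-embW U) lenU)) (cong suc (+-comm K 1)))

-- The zero entry.  A word starting x x̄ has encoding starting with 1; if its
-- derivative starts with 2, that 1 is the optional left pad, so the word
-- starts with x x̄ x̄.
Δ-alternating-start : ∀ x t d → Δ (x ∷ other x ∷ t) ≡ just d → ∃ λ d' → d ≡ one ∷ d'
Δ-alternating-start x t d e = first-run-one d (trans (sym (runs-alternating x)) (allToSym-inverse _ d e))
  where
  runs-alternating : ∀ x → runs (x ∷ other x ∷ t) ≡ 1 ∷ runsFrom (other x) 1 t
  runs-alternating one = refl
  runs-alternating two = refl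
  first-run-one : ∀ d → 1 ∷ runsFrom (other x) 1 t ≡ map runLength d → ∃ λ d' → d ≡ one ∷ d'
  first-run-one (one ∷ d) _ = d , refl

alternating-start-prefix : ∀ x t bs → D (x ∷ other x ∷ t) ≡ just (two ∷ bs) → IsPrefix (x ∷ other x ∷ other x ∷ []) (x ∷ other x ∷ t)
alternating-start-prefix x t bs dd with D-defined (x ∷ other x ∷ t) (two ∷ bs) dd
... | d , eΔ , dd' with primitive-shape d (two ∷ bs) (λ ()) dd'
... | l , r , refl , inj₁ refl , rp with () ← Δ-alternating-start x t (two ∷ bs ++ r) eΔ
... | .(one ∷ []) , r , refl , inj₂ (refl , _) , rp =
  decode (other (other x)) (bs ++ r) , sym (decode-Δ x (other x ∷ t) (one ∷ two ∷ bs ++ r) eΔ)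

zero-entry-prefix : ∀ a b x → frontierEntry a b ≡ z0 → AtLeastTwo a → b ≢ [] → at a 0 ≡ just x → D a ≡ just b →
     IsPrefix (x ∷ other x ∷ other x ∷ []) a
zero-entry-prefix .(x' ∷ y' ∷ t) [] x e (x' , y' , t , refl) ne _ _ = ⊥-elim (ne refl)
zero-entry-prefix .(one ∷ one ∷ t) (one ∷ bs) x () (one , one , t , refl) ne a0 dd
zero-entry-prefix .(one ∷ one ∷ t) (two ∷ bs) x () (one , one , t , refl) ne a0 dd
zero-entry-prefix .(two ∷ two ∷ t) (one ∷ bs) x () (two , two , t , refl) ne a0 dd
zero-entry-prefix .(two ∷ two ∷ t) (two ∷ bs) x () (two , two , t , refl) ne a0 dd
zero-entry-prefix .(one ∷ two ∷ t) (one ∷ bs) x () (one , two , t , refl) ne a0 dd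
zero-entry-prefix .(two ∷ one ∷ t) (one ∷ bs) x () (two , one , t , refl) ne a0 dd
zero-entry-prefix .(one ∷ two ∷ t) (two ∷ bs) .one refl (one , two , t , refl) ne refl dd = alternating-start-prefix one t bs dd
zero-entry-prefix .(two ∷ one ∷ t) (two ∷ bs) .two refl (two , one , t , refl) ne refl dd = alternating-start-prefix two t bs dd

-- The theorem.  Throughout, u is a single-rooted minimal word of height K+1
-- with root letter x and left frontier U.
module Extensions (u U : List Sym) (srm : SingleRootedMinimal u) (lf : LeftFrontier u (embW U)) where

  K : ℕ
  K = proj₁ (proj₂ (proj₁ srm))

  x : Sym
  x = proj₁ (proj₂ (proj₂ (proj₂ (proj₁ srm))))

  height-u : Height u (suc K)
  height-u = proj₁ (proj₂ (proj₂ (proj₁ srm)))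

  la : ℕ → List Sym
  la = tower (proj₁ (proj₁ srm))

  tower-u : Tower u la
  tower-u = tower-ok (proj₁ (proj₁ srm))

  root-u : la K ≡ x ∷ []
  root-u = just-injective (trans (sym (tower-u K)) (proj₂ (proj₂ (proj₂ (proj₂ (proj₁ srm))))))

  length-U : length U ≡ suc K
  length-U with k , H , _ , lenF , _ ← leftFrontier-elim u (embW U) la lf tower-u =
    trans (sym (length-embW U)) (trans lenF (height-unique H height-u))

  index-U : ∀ {i} → i < suc K → i < length U
  index-U {i} = subst (i <_) (sym length-U)

  letters-u : (∀ j → j ≤ K → at (la j) 0 ≡ just (letterAt U j)) × (∀ j → j < K → DoubledStart (la j) (la (suc j)))
  letters-u = frontier-first-letters u (embW U) la K U tower-u lf length-U
                (subst (suc K ≤_) (sym (trans (length-embW U) length-U)) ≤-refl) (λ i _ → refl)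

  last-letter : letterAt U K ≡ x
  last-letter = trans (sym (first-at (la K) (letterAt U K) (proj₁ letters-u K ≤-refl))) (cong first root-u)

  -- u is a prefix of every word whose left frontier begins with U: its tower
  -- is a lift of the root x, and level K of the other word starts with x.
  prefix-of-frontier-extension : ∀ b F → LeftFrontier b F → suc K ≤ length F →
    (∀ i → i < suc K → at F i ≡ at (embW U) i) → IsPrefix u b
  prefix-of-frontier-extension b F lfb K<F agree = subst₂ IsPrefix (Tower-base tower-u) (Tower-base tower-b)
       (prefix-tower K la lb (λ j p → below-height-nonempty tower-u height-u j (s≤s p)) root-prefix
          (λ j p → minimal-tower-Δ u la (suc K) tower-u height-u (proj₂ srm) j (s≤s p)) (λ j _ → Tower-D tower-b j)
          (λ j p → trans (proj₁ letters-u j (<⇒≤ p)) (sym (proj₁ letters-b j (<⇒≤ p)))) (proj₂ letters-b) 0 z≤n)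
    where
    lb : ℕ → List Sym
    lb = tower (proj₁ lfb)
    tower-b : Tower b lb
    tower-b = tower-ok (proj₁ lfb)
    letters-b : (∀ j → j ≤ K → at (lb j) 0 ≡ just (letterAt U j)) × (∀ j → j < K → DoubledStart (lb j) (lb (suc j)))
    letters-b = frontier-first-letters b F lb K U tower-b lfb length-U K<F agree
    root-prefix : IsPrefix (la K) (lb K)
    root-prefix with lb K | proj₁ letters-b K ≤-refl
    ... | c ∷ t | e rewrite root-u | last-letter = t , cong (_∷ t) (just-injective (sym e))

  prefix-of-extension : ∀ (z : Sym0) (w : List Sym) → LeftFrontier w (embW U ++ z ∷ []) → IsPrefix u w
  prefix-of-extension z w lfw = prefix-of-frontier-extension w (embW U ++ z ∷ []) lfw
    (subst (suc K ≤_) (sym (length-embW-∷ʳ U z K length-U)) (n≤1+n (suc K))) (at-embW-∷ʳ U z K length-U)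

  module AlongU (ρ : ℕ → List Sym) (ρ-D : ∀ j → D (ρ j) ≡ just (ρ (suc j))) (ρ-ne : ρ 0 ≢ []) (ρ-first : at (ρ 0) 0 ≡ just x) where
    open Lift ρ ρ-D ρ-ne

    level : ℕ → List Sym
    level = lift ρ (letterAt U) K

    level-tower : Tower (level 0) level
    level-tower = lift-tower K (letterAt U)

    level-root : level K ≡ ρ 0
    level-root = lift-root K (letterAt U)

    level-above-root : level (suc K) ≡ ρ 1
    level-above-root = lift-above-root K (letterAt U)

    level-step : ∀ j → j < K → level j ≡ decode (letterAt U j) (pad (level (suc j)))
    level-step = lift-step K (letterAt U)

    level-Δ : ∀ j → j < K → Δ (level j) ≡ just (pad (level (suc j)))
    level-Δ = lift-Δ K (letterAt U)

    level-first : ∀ j → j ≤ K → at (level j) 0 ≡ just (letterAt U j)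
    level-first j p with m≤n⇒m<n∨m≡n p
    ... | inj₁ q = lift-first K (letterAt U) j q
    ... | inj₂ refl = trans (cong (λ v → at v 0) (lift-root K (letterAt U))) (trans ρ-first (cong just (sym last-letter)))

    frontier-start : at (embW U) 0 ≡ just (emb (first (level 0)))
    frontier-start = trans (at-embW U 0 (index-U (s≤s z≤n)))
                       (cong (λ c → just (emb c)) (sym (first-at (level 0) (letterAt U 0) (level-first 0 z≤n))))

    frontier-entry : ∀ m → m < K → at (embW U) (suc m) ≡ just (frontierEntry (level m) (level (suc m)))
    frontier-entry m q = trans (at-embW U (suc m) (index-U (s≤s q))) (cong just (sym (begin
      frontierEntry (level m) (level (suc m))
        ≡⟨ cong (λ v → frontierEntry v (level (suc m))) (lift-step K (letterAt U) m q) ⟩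
      frontierEntry (decode (letterAt U m) (pad (level (suc m)))) (level (suc m))
        ≡⟨ frontierEntry-pad (letterAt U m) (level (suc m)) (lift-nonempty-above K (letterAt U) m q) ⟩
      emb (first (level (suc m)))
        ≡⟨ cong emb (first-at (level (suc m)) (letterAt U (suc m)) (level-first (suc m) q)) ⟩
      emb (letterAt U (suc m)) ∎)))
      where open ≡-Reasoning

  -- The double-rooted minimal word with left frontier U: the lift of x x̄.
  module E = AlongU (rootDouble x) (D-rootDouble x) (λ ()) refl

  E-height : Height (E.level 0) (suc K)
  E-height = Lift.lift-height-one (rootDouble x) (D-rootDouble x) (λ ()) refl K (letterAt U)

  E-double-rooted-minimal : DoubleRootedMinimal (E.level 0)
  E-double-rooted-minimal = (Tower-C∞ E.level-tower , K , E-height , x , other x ,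
                              trans (E.level-tower K) (cong just E.level-root)) ,
                            Lift.lift-minimal (rootDouble x) (D-rootDouble x) (λ ()) K (letterAt U) refl

  E-left-frontier : LeftFrontier (E.level 0) (embW U)
  E-left-frontier = leftFrontier-intro (E.level 0) E.level (suc K) (embW U) E.level-tower E-height (s≤s z≤n)
    (trans (length-embW U) length-U) E.frontier-start (λ { m (s≤s q) → E.frontier-entry m q })

  E-right-frontier-letters : List Sym0
  E-right-frontier-letters = frontier (λ j → reverse (E.level j)) (suc K)

  E-right-frontier : RightFrontier (E.level 0) E-right-frontier-letters
  E-right-frontier = leftFrontier-frontier (reverse (E.level 0)) (λ j → reverse (E.level j)) (suc K)
                       (Tower-reverse E.level-tower) (height-reverse E.level-tower E-height) (s≤s z≤n)

  -- The right 0-extension: the lift of x x̄ x̄ (whose derivative is 2) along U.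
  module W = AlongU (rootZero x) (D-rootZero x) (λ ()) refl

  U0 : List Sym0
  U0 = embW U ++ z0 ∷ []

  W-top : W.level K ≡ x ∷ other x ∷ other x ∷ []
  W-top = W.level-root

  W-root : W.level (suc K) ≡ two ∷ []
  W-root = W.level-above-root

  W-height : Height (W.level 0) (suc (suc K))
  W-height = subst (Height (W.level 0)) (+-comm K 2)
               (Lift.lift-height (rootZero x) (D-rootZero x) (λ ()) 2 root-nonempty refl K (letterAt U))
    where
    root-nonempty : ∀ j → j < 2 → rootZero x j ≢ []
    root-nonempty zero _ ()
    root-nonempty (suc zero) _ ()
    root-nonempty (suc (suc j)) (s≤s (s≤s ()))

  at-U0-last : at U0 (suc K) ≡ just z0
  at-U0-last = subst (λ n → at U0 n ≡ just z0) (trans (length-embW U) length-U) (at-++-len (embW U) z0 [])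

  W-left-frontier : LeftFrontier (W.level 0) U0
  W-left-frontier = leftFrontier-intro (W.level 0) W.level (suc (suc K)) U0 W.level-tower W-height (s≤s z≤n)
    (length-embW-∷ʳ U z0 K length-U) (trans (at-embW-∷ʳ U z0 K length-U 0 (s≤s z≤n)) W.frontier-start) entries
    where
    zero-entry : ∀ y → entry y (other y) two ≡ z0
    zero-entry one = refl
    zero-entry two = refl
    entries : ∀ m → suc m < suc (suc K) → at U0 (suc m) ≡ just (frontierEntry (W.level m) (W.level (suc m)))
    entries m (s≤s p) with m≤n⇒m<n∨m≡n p
    ... | inj₁ (s≤s q) = trans (at-embW-∷ʳ U z0 K length-U (suc m) (s≤s q)) (W.frontier-entry m q)
    ... | inj₂ refl = trans at-U0-last (cong just (sym (trans (cong₂ frontierEntry W-top W-root) (zero-entry x))))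

  U0-letters : ∀ w (lfw : LeftFrontier w U0) →
    (∀ j → j ≤ K → at (tower (proj₁ lfw) j) 0 ≡ just (letterAt U j)) ×
    (∀ j → j < K → DoubledStart (tower (proj₁ lfw) j) (tower (proj₁ lfw) (suc j)))
  U0-letters w lfw = frontier-first-letters w U0 (tower (proj₁ lfw)) K U (tower-ok (proj₁ lfw)) lfw length-U
    (subst (suc K ≤_) (sym (length-embW-∷ʳ U z0 K length-U)) (n≤1+n (suc K))) (at-embW-∷ʳ U z0 K length-U)

  U0-top-level : ∀ w (lfw : LeftFrontier w U0) → IsPrefix (x ∷ other x ∷ other x ∷ []) (tower (proj₁ lfw) K)
  U0-top-level w lfw with hw , height-w , _ , length-U0 , _ , entries ← leftFrontier-elim w U0 _ lfw (tower-ok (proj₁ lfw)) =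
    zero-entry-prefix (lw K) (lw (suc K)) x entry-K (Tower-long tower-w height-w K K+1<hw)
      (below-height-nonempty tower-w height-w (suc K) K+1<hw)
      (trans (proj₁ (U0-letters w lfw) K ≤-refl) (cong just last-letter)) (Tower-D tower-w K)
    where
    lw : ℕ → List Sym
    lw = tower (proj₁ lfw)
    tower-w : Tower w lw
    tower-w = tower-ok (proj₁ lfw)
    K+1<hw : suc K < hw
    K+1<hw = subst (suc K <_) (trans (sym (length-embW-∷ʳ U z0 K length-U)) length-U0) ≤-refl
    entry-K : frontierEntry (lw K) (lw (suc K)) ≡ z0
    entry-K = just-injective (trans (sym (entries K K+1<hw)) at-U0-last)

  W-prefix : ∀ w → LeftFrontier w U0 → IsPrefix (W.level 0) w
  W-prefix w lfw = subst (IsPrefix (W.level 0)) (Tower-base (tower-ok (proj₁ lfw)))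
      (prefix-tower K W.level (tower (proj₁ lfw)) (λ j p → below-height-nonempty W.level-tower W-height j (s≤s (m≤n⇒m≤1+n p)))
        (subst (λ v → IsPrefix v (tower (proj₁ lfw) K)) (sym W-top) (U0-top-level w lfw))
        W.level-Δ (λ j _ → Tower-D (tower-ok (proj₁ lfw)) j)
        (λ j p → trans (W.level-first j (<⇒≤ p)) (sym (proj₁ (U0-letters w lfw) j (<⇒≤ p)))) (proj₂ (U0-letters w lfw)) 0 z≤n)

  module ZeroExtension (u₀ : List Sym) (lf₀ : LeftFrontier u₀ U0) (shortest : ∀ v → LeftFrontier v U0 → length u₀ ≤ length v) where

    W≡u₀ : W.level 0 ≡ u₀
    W≡u₀ = prefix-length-eq (W.level 0) u₀ (W-prefix u₀ lf₀) (shortest (W.level 0) W-left-frontier)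

    tower-u₀ : Tower u₀ W.level
    tower-u₀ = subst (λ w → Tower w W.level) W≡u₀ W.level-tower

    height-u₀ : Height u₀ (suc (suc K))
    height-u₀ = subst (λ w → Height w (suc (suc K))) W≡u₀ W-height

    single-rooted : SingleRooted u₀
    single-rooted = Tower-C∞ tower-u₀ , suc K , height-u₀ , two , trans (tower-u₀ (suc K)) (cong just W-root)

    -- Level K (length 3) is not the shortest primitive of 2 (which is 11).
    not-minimal : ¬ Minimal u₀
    not-minimal mn = n≮n 2 (subst (λ v → length v ≤ 2) W-top
      (Minimal→condition u₀ W.level (suc (suc K)) tower-u₀ height-u₀ mn K ≤-refl (one ∷ one ∷ []) (cong just (sym W-root))))

    module MinimalPartOf (m : List Sym) (srm-m : SingleRootedMinimal m) (height-m : Height m (suc (suc K)))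
                         (p s : List Sym) (occurs : p ++ m ++ s ≡ u₀) where

      lm : ℕ → List Sym
      lm = tower (proj₁ (proj₁ srm-m))

      tower-m : Tower m lm
      tower-m = tower-ok (proj₁ (proj₁ srm-m))

      a : Sym
      a = proj₁ (proj₂ (proj₂ (proj₂ (proj₁ srm-m))))

      m-root : lm (suc K) ≡ a ∷ []
      m-root = just-injective (trans (sym (tower-m (suc K)))
        (subst (λ j → Dⁿ j m ≡ just (a ∷ [])) (suc-injective (height-unique (proj₁ (proj₂ (proj₂ (proj₁ srm-m)))) height-m))
          (proj₂ (proj₂ (proj₂ (proj₂ (proj₁ srm-m)))))))

      m-nonempty : ∀ j → j < suc (suc K) → lm j ≢ []
      m-nonempty = below-height-nonempty tower-m height-m

      m-shortest : ∀ j → j < suc K → lm j ≡ decode (first (lm j)) (pad (lm (suc j)))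
      m-shortest j q = decode-form (lm j) _ (m-nonempty j (m≤n⇒m≤1+n q)) (minimal-tower-Δ m lm _ tower-m height-m (proj₂ srm-m) j (s≤s q))

      Occurrence : ℕ → List Sym → List Sym → Set
      Occurrence j P S = P ++ lm j ++ S ≡ W.level j

      occurrence-step : ∀ j → j < K → ∀ P S → Occurrence j P S →
        ∃₂ λ P' S' → W.level (suc j) ≡ P' ++ lm (suc j) ++ S' ×
                     (lpad (lm (suc j)) ≡ [] → P ≡ decode (letterAt U j) (lpad (W.level (suc j)) ++ P')) ×
                     (lpad (lm (suc j)) ≡ one ∷ [] → P ++ first (lm j) ∷ [] ≡ decode (letterAt U j) (lpad (W.level (suc j)) ++ P'))
      occurrence-step j q P S e = occurrence-descends (letterAt U j) (W.level (suc j)) (lm (suc j)) P S (first (lm j))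
        (m-nonempty (suc j) (s≤s (m≤n⇒m≤1+n q)))
        (subst₂ (λ v w → P ++ v ++ S ≡ w) (m-shortest j (m≤n⇒m≤1+n q)) (W.level-step j q) e)

      occurrence-at-level : ∀ j → j ≤ K → ∃₂ λ P S → Occurrence j P S
      occurrence-at-level zero _ = p , s , subst₂ (λ v w → p ++ v ++ s ≡ w) (sym (Tower-base tower-m)) (sym (Tower-base tower-u₀)) occurs
      occurrence-at-level (suc j) q with P , S , e ← occurrence-at-level j (<⇒≤ q)
        with P' , S' , eW , _ ← occurrence-step j q P S e = P' , S' , sym eW

      at-root : ∀ P S → Occurrence K P S → P ≡ x ∷ [] × a ≡ two × first (lm K) ≡ other x
      at-root P S e = occurrence-at-root x (first (lm K)) a P S
        (subst₂ (λ v w → P ++ v ++ S ≡ w) (trans (m-shortest K ≤-refl) (cong (λ z → decode (first (lm K)) (pad z)) m-root)) W-top e)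

      root-pinned : a ≡ two × first (lm K) ≡ other x
      root-pinned with P , S , e ← occurrence-at-level K ≤-refl = proj₂ (at-root P S e)

      m-root-two : a ≡ two
      m-root-two = proj₁ root-pinned

      m-top : lm K ≡ other x ∷ other x ∷ []
      m-top = trans (m-shortest K ≤-refl)
        (cong₂ (λ c z → decode c (pad z)) (proj₂ root-pinned) (trans m-root (cong (_∷ []) m-root-two)))

      -- C: the lift of x̄ along the first letters of m, a single-rooted
      -- minimal word of height K+1 whose levels are prefixes of those of m.
      module CL = Lift (rootSingle (other x)) (D-rootSingle (other x)) (λ ())

      fm : ℕ → Sym
      fm j = first (lm j)

      C : ℕ → List Sym
      C = lift (rootSingle (other x)) fm K

      C-tower : Tower (C 0) C
      C-tower = CL.lift-tower K fm

      C-height : Height (C 0) (suc K)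
      C-height = CL.lift-height-one refl K fm

      C-nonempty : ∀ j → j ≤ K → C j ≢ []
      C-nonempty j q = below-height-nonempty C-tower C-height j (s≤s q)

      C-prefix-m : ∀ j → j ≤ K → IsPrefix (C j) (lm j)
      C-prefix-m = prefix-tower K C lm C-nonempty (subst₂ IsPrefix (sym (CL.lift-root K fm)) (sym m-top) (other x ∷ [] , refl))
        (CL.lift-Δ K fm) (λ j _ → Tower-D tower-m j)
        (λ j q → trans (CL.lift-first K fm j q) (sym (at-first (lm j) (m-nonempty j (m≤n⇒m≤1+n (m≤n⇒m≤1+n q))))))
        (λ j q → subst (λ v → DoubledStart v (lm (suc j))) (sym (m-shortest j (m≤n⇒m≤1+n q))) (pad-DoubledStart (fm j) (lm (suc j))))

      -- Levels of C are suffixes of the levels of E: at level K, x ∷ x̄ = x x̄;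
      -- below, occurrences descend and suffixes ascend.
      C-suffix-E-from : ∀ n j → j + n ≡ K → ∀ P S → Occurrence j P S → P ++ C j ≡ E.level j
      C-suffix-E-from zero j e P S occ with refl ← trans (sym (+-identityʳ j)) e
        rewrite proj₁ (at-root P S occ) | CL.lift-root K fm | E.level-root = refl
      C-suffix-E-from (suc n) j e P S occ
        with P' , S' , eW , h1 , h2 ← occurrence-step j (+-suc-≡⇒< j n e) P S occ
        with X , C⊑m ← C-prefix-m (suc j) (+-suc-≡⇒< j n e)
        = begin
          P ++ C j
            ≡⟨ cong (P ++_) (CL.lift-step K fm j (+-suc-≡⇒< j n e)) ⟩
          P ++ decode (fm j) (pad (C (suc j)))
            ≡⟨ suffix-ascends (letterAt U j) (fm j) (W.level (suc j)) (lm (suc j)) (C (suc j)) P' S' X P S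
                 (C-nonempty (suc j) (+-suc-≡⇒< j n e)) eW (sym C⊑m) h1 h2
                 (subst₂ (λ v w → P ++ v ++ S ≡ w) (m-shortest j (m≤n⇒m≤1+n (+-suc-≡⇒< j n e))) (W.level-step j (+-suc-≡⇒< j n e)) occ) ⟩
          decode (letterAt U j) (pad (P' ++ C (suc j)))
            ≡⟨ cong (λ z → decode (letterAt U j) (pad z)) (C-suffix-E-from n (suc j) (trans (sym (+-suc j n)) e) P' S' (sym eW)) ⟩
          decode (letterAt U j) (pad (E.level (suc j)))
            ≡⟨ sym (E.level-step j (+-suc-≡⇒< j n e)) ⟩
          E.level j ∎
        where open ≡-Reasoning

      reverse-C-prefix : ∀ j → j ≤ K → IsPrefix (reverse (C j)) (reverse (E.level j))
      reverse-C-prefix j q with P , S , occ ← occurrence-at-level j q =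
        reverse P , trans (sym (reverse-++ P (C j))) (cong reverse (C-suffix-E-from (K ∸ j) j (m+[n∸m]≡n q) P S occ))

      -- The reversal of C is single-rooted minimal with left frontier Γd(U)
      -- and right frontier T, the first K+1 frontier letters of m.
      T : List Sym0
      T = frontier lm (suc K)

      rC-tower : Tower (reverse (C 0)) (λ j → reverse (C j))
      rC-tower = Tower-reverse C-tower

      rC-height : Height (reverse (C 0)) (suc K)
      rC-height = height-reverse C-tower C-height

      rC-single-rooted-minimal : SingleRootedMinimal (reverse (C 0))
      rC-single-rooted-minimal =
        (Tower-C∞ rC-tower , K , rC-height , other x , trans (rC-tower K) (cong (λ v → just (reverse v)) (CL.lift-root K fm))) ,
        condition→Minimal (reverse (C 0)) (λ j → reverse (C j)) (suc K) rC-tower rC-height (s≤s z≤n)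
          (condition-reverse C (suc K) (Minimal→condition (C 0) C (suc K) C-tower C-height (CL.lift-minimal K fm refl)))

      rC-left-frontier : LeftFrontier (reverse (C 0)) E-right-frontier-letters
      rC-left-frontier = leftFrontier-prefix-tower (reverse (C 0)) (λ j → reverse (C j)) (λ j → reverse (E.level j)) K
                           rC-tower rC-height reverse-C-prefix

      rC-right-frontier : RightFrontier (reverse (C 0)) T
      rC-right-frontier = subst (λ w → LeftFrontier w T) (sym (reverse-involutive (C 0)))
                            (leftFrontier-prefix-tower (C 0) C lm K C-tower C-height C-prefix-m)

      -- The frontier of m is T followed by the entry of x̄ x̄ under 2, namely 2.
      m-left-frontier : LeftFrontier m (T ++ z2 ∷ [])
      m-left-frontier = subst (λ z → LeftFrontier m (T ++ z ∷ [])) top-entry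
                          (leftFrontier-frontier m lm (suc (suc K)) tower-m height-m (s≤s z≤n))
        where
        doubled-entry : ∀ y → entry y y two ≡ z2
        doubled-entry one = refl
        doubled-entry two = refl
        top-entry : frontierEntry (lm K) (lm (suc K)) ≡ z2
        top-entry = trans (cong₂ frontierEntry m-top (trans m-root (cong (_∷ []) m-root-two))) (doubled-entry (other x))

      minimal-part-frontier : ∃ λ T → Θ (embW U) T × SingleRootedMinimal m × LeftFrontier m (T ++ z2 ∷ [])
      minimal-part-frontier =
        T , (E-right-frontier-letters , (E.level 0 , E-double-rooted-minimal , E-left-frontier , E-right-frontier) ,
                                        (reverse (C 0) , rC-single-rooted-minimal , rC-left-frontier , rC-right-frontier)) ,
        srm-m , m-left-frontier

    zero-extension : IsPrefix u u₀ × SingleRooted u₀ × ¬ Minimal u₀ ×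
      ((m : List Sym) → MinimalPart u₀ m → ∃ λ T → Θ (embW U) T × SingleRootedMinimal m × LeftFrontier m (T ++ z2 ∷ []))
    zero-extension = prefix-of-extension z0 u₀ lf₀ , single-rooted , not-minimal , minimal-part
      where
      minimal-part : (m : List Sym) → MinimalPart u₀ m → ∃ λ T → Θ (embW U) T × SingleRootedMinimal m × LeftFrontier m (T ++ z2 ∷ [])
      minimal-part m (k , height-k , _ , p , (srm-m , height-m , s , occurs) , _) =
        MinimalPartOf.minimal-part-frontier m srm-m (subst (Height m) (height-unique height-k height-u₀) height-m) p s occurs

theorem5 : (u : List Sym) (U : List Sym) →
    SingleRootedMinimal u → LeftFrontier u (embW U) →
    ((u₁ : List Sym) → SingleRootedMinimal u₁ → LeftFrontier u₁ (embW U ++ z1 ∷ []) → IsPrefix u u₁) ×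
    ((u₂ : List Sym) → SingleRootedMinimal u₂ → LeftFrontier u₂ (embW U ++ z2 ∷ []) → IsPrefix u u₂) ×
    ((u₀ : List Sym) → LeftFrontier u₀ (embW U ++ z0 ∷ []) →
    ((v : List Sym) → LeftFrontier v (embW U ++ z0 ∷ []) → length u₀ ≤ length v) →
    IsPrefix u u₀ × SingleRooted u₀ × ¬ Minimal u₀ ×
    ((m : List Sym) → MinimalPart u₀ m →
    ∃ λ T → Θ (embW U) T × SingleRootedMinimal m × LeftFrontier m (T ++ z2 ∷ [])))
theorem5 u U srm lf =
  (λ u₁ _ lf₁ → prefix-of-extension z1 u₁ lf₁) ,
  (λ u₂ _ lf₂ → prefix-of-extension z2 u₂ lf₂) ,
  (λ u₀ lf₀ shortest → ZeroExtension.zero-extension u₀ lf₀ shortest)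
  where open Extensions u U srm lf
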